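{- Let $G=(V,E)$ be a $D$-complete graph, with $\mathsf{GE}(G)=(\varnothing,\varnothing,D)$. Let $L$ be a maximal clique of $G$ of size $2\kappa+1$ with $\kappa$ a positive integer, let $S\subseteq L$ with $|S|=\kappa$, and let $K\subseteq V\setminus S$ be a scattered set with $|K|>\kappa$. Let $G'$ be obtained from $G$ by deleting all edges with both endpoints in $L$ and then adding all pairs with both endpoints in $S$ and all pairs $\{s,k\}$ with $s\in S$, $k\in K$, $s\neq k$. Write $\mathsf{GE}(G')=(C',A',D')$. Then $C'=\varnothing$, $A'=S$, $D'=D\setminus S$, and $\nu(G')=\nu(G)$. Moreover, the connected components of $G'[D']$ are the connected components of $G$ other than $L$, together with the $\kappa+1$ vertices of $L\setminus S$ as isolated vertices.
   Context: $\nu$ denotes the matching number. A vertex is essential if covered by every maximum matching, inessential otherwise. The Gallai--Edmonds decomposition $\mathsf{GE}(G)=(C,A,D)$: $D$ is the set of inessential vertices, $A$ the set of vertices in $V\setminus D$ adjacent to some vertex of $D$, $C=V\setminus(D\cup A)$. A graph is $D$-complete if it is a vertex-disjoint union of cliques of odd size (isolated vertices allowed), so its Gallai--Edmonds decomposition has the form $(\varnothing,\varnothing,D)$. A set $K$ of vertices is scattered (in $G$) if its vertices all belong to distinct cliques (components) of $G$. -}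

module Defs where

open import Data.Nat using (ℕ; suc; _+_; _*_; _≤_)
open import Data.Fin using (Fin; _≟_)
open import Data.Bool using (Bool; true; false; _∧_; _∨_; not; if_then_else_)
open import Data.List using (List; []; _∷_; length; filterᵇ; concatMap)
open import Data.List.Relation.Unary.All using (All)
open import Data.List.Relation.Unary.Unique.Propositional using (Unique)
open import Data.List.Membership.Propositional using (_∈_)
open import Data.List using (allFin)
open import Data.Product using (Σ; ∃; _×_; _,_)
open import Data.Sum using (_⊎_)
open import Data.Unit using (⊤)
open import Relation.Nullary using (¬_; does)
open import Relation.Binary.PropositionalEquality using (_≡_; _≢_)

Graph : ℕ → Set
Graph n = Fin n → Fin n → Bool

VSet : ℕ → Set
VSet n = Fin n → Bool

module _ {n : ℕ} where

  IsSimple : Graph n → Set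
  IsSimple G = (∀ u v → G u v ≡ G v u) × (∀ v → G v v ≡ false)

  card : VSet n → ℕ
  card P = length (filterᵇ P (allFin n))

  _≡ᵇ_ : Fin n → Fin n → Bool
  u ≡ᵇ v = does (u ≟ v)

  closedNbhd : Graph n → Fin n → VSet n
  closedNbhd G v w = (w ≡ᵇ v) ∨ G v w

  Odd : ℕ → Set
  Odd m = ∃ λ k → m ≡ 1 + 2 * k

  -- D-complete: vertex-disjoint union of cliques of odd size
  -- (adjacency is transitive on distinct vertices, and each vertex's
  --  clique, i.e. its closed neighbourhood, has odd size)
  DComplete : Graph n → Set
  DComplete G =
    (∀ u v w → G u v ≡ true → G v w ≡ true → u ≢ w → G u w ≡ true)
    × (∀ v → Odd (card (closedNbhd G v)))

  _⊆_ : VSet n → VSet n → Set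
  A ⊆ B = ∀ v → A v ≡ true → B v ≡ true

  IsClique : Graph n → VSet n → Set
  IsClique G L = ∀ u v → L u ≡ true → L v ≡ true → u ≢ v → G u v ≡ true

  IsMaximalClique : Graph n → VSet n → Set
  IsMaximalClique G L = IsClique G L × (∀ L′ → IsClique G L′ → L ⊆ L′ → L′ ⊆ L)

  -- paths in G all of whose vertices after the start lie in P
  data Reach (G : Graph n) (P : Fin n → Set) : Fin n → Fin n → Set where
    here : ∀ {u} → Reach G P u u
    step : ∀ {u v w} → G u v ≡ true → P v → Reach G P v w → Reach G P u w

  Everything : Fin n → Set
  Everything _ = ⊤

  Scattered : Graph n → VSet n → Set
  Scattered G K = ∀ u v → K u ≡ true → K v ≡ true → u ≢ v → ¬ Reach G Everything u v

  Matching : Set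
  Matching = List (Fin n × Fin n)

  endpoints : Matching → List (Fin n)
  endpoints = concatMap (λ { (u , v) → u ∷ v ∷ [] })

  IsMatching : Graph n → Matching → Set
  IsMatching G M = All (λ { (u , v) → G u v ≡ true }) M × Unique (endpoints M)

  IsMaximumMatching : Graph n → Matching → Set
  IsMaximumMatching G M = IsMatching G M × (∀ M′ → IsMatching G M′ → length M′ ≤ length M)

  MatchingNumber : Graph n → ℕ → Set
  MatchingNumber G k = ∃ λ M → IsMaximumMatching G M × length M ≡ k

  InD : Graph n → Fin n → Set
  InD G v = ∃ λ M → IsMaximumMatching G M × ¬ (v ∈ endpoints M)

  InA : Graph n → Fin n → Set
  InA G v = ¬ InD G v × (∃ λ w → InD G w × G v w ≡ true)

  InC : Graph n → Fin n → Set
  InC G v = ¬ (InD G v ⊎ InA G v)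

  modify : Graph n → (L S K : VSet n) → Graph n
  modify G L S K u v =
    (G u v ∧ not (L u ∧ L v))
    ∨ (not (u ≡ᵇ v) ∧ ((S u ∧ S v) ∨ (S u ∧ K v) ∨ (K u ∧ S v)))

module Submission where

open import Defs
open import Data.Nat using (ℕ; zero; suc; _<_; _≤_; _*_; _+_; _⊓_; z≤n; s≤s)
open import Data.Nat.Properties
open import Data.Nat.Tactic.RingSolver using (solve-∀)
open import Algebra.Properties.CommutativeSemigroup +-commutativeSemigroup using (xy∙z≈xz∙y)
open import Data.Fin using (Fin) renaming (_≟_ to _≟ᶠ_)
open import Data.Bool using (Bool; true; false; _∧_; _∨_; not; T; if_then_else_)
open import Data.Bool.Properties
  using (T-≡; ∨-inverseʳ; ∨-identityʳ; ∧-comm; ∧-assoc; ∧-zeroʳ; ∧-identityʳ; ¬-not; not-¬; not-injective)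
open import Data.Bool.Solver using (module ∨-∧-Solver)
open import Data.List using (List; []; _∷_; length; filterᵇ; _++_; map; allFin; zip; take)
open import Data.List.Properties
  using (length-++; length-map; length-tabulate; length-take; length-zipWith; filter-≐)
open import Data.List.Membership.Propositional using (_∈_; _∉_)
open import Data.List.Membership.Propositional.Properties
  using (∈-∃++; ∈-++⁺ˡ; ∈-++⁺ʳ; ∈-++⁻; ∈-allFin; ∈-filter⁺; ∈-filter⁻; ∈-map⁻)
open import Data.List.Relation.Unary.Any using (here; there)
open import Data.List.Relation.Unary.All as All using (All; []; _∷_)
import Data.List.Relation.Unary.All.Properties as Allₚ
open import Data.List.Relation.Unary.Unique.Propositional using (Unique; []; _∷_)
open import Data.List.Relation.Unary.Unique.Propositional.Properties
  using (allFin⁺; filter⁺; take⁺; ++⁺; Unique[x∷xs]⇒x∉xs)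
open import Data.Product using (Σ; ∃; _×_; _,_; proj₁; proj₂)
open import Data.Sum using (_⊎_; inj₁; inj₂)
open import Data.Empty using (⊥; ⊥-elim)
open import Data.Unit using (tt)
open import Function using (_∘_)
open import Function.Bundles using (_⇔_; mk⇔; Equivalence)
open import Relation.Nullary using (¬_; Dec; yes; no; does)
open import Relation.Nullary.Decidable using (T?; dec-true; dec-false; does-⇔)
open import Relation.Binary.PropositionalEquality

-- Every component of G is an odd clique, so for each v some matching misses exactly one vertex
-- per component, v among them; it is maximum, hence every vertex of G is inessential. In G′
-- the vertices of L ∖ S become isolated and S is joined to K. Since K is scattered and
-- |K| > κ, for every v ∉ S one can match S to κ vertices of K lying outside the component of
-- v, and match the remaining vertices near-perfectly inside their components avoiding v. The
-- exposed vertices of this matching together with the chosen vertices of K lie in distinct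
-- components of G′ − S, all of which are odd cliques. The Tutte–Berge bound with barrier S
-- (each odd component of G′ − S has a vertex that is exposed or matched into S) then shows
-- that this matching is maximum and that every maximum matching of G′ covers S. Hence
-- D′ = V ∖ S, A′ = S, C′ = ∅, and mapping the G′-edges off S back to G and re-matching L
-- near-perfectly gives a maximum matching of G of the same size.

∧-intro : ∀ {a b} → a ≡ true → b ≡ true → a ∧ b ≡ true
∧-intro refl refl = refl

∧-elimˡ : ∀ {a b} → a ∧ b ≡ true → a ≡ true
∧-elimˡ {true} _ = refl

∧-elimʳ : ∀ {a b} → a ∧ b ≡ true → b ≡ true
∧-elimʳ {true} e = e

∨-introˡ : ∀ {a} b → a ≡ true → a ∨ b ≡ true
∨-introˡ _ refl = refl

∨-introʳ : ∀ a {b} → b ≡ true → a ∨ b ≡ true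
∨-introʳ true _ = refl
∨-introʳ false e = e

∨-elim : ∀ {a b} → a ∨ b ≡ true → a ≡ true ⊎ b ≡ true
∨-elim {true} _ = inj₁ refl
∨-elim {false} e = inj₂ e

∨-false : ∀ {a b} → a ∨ b ≡ false → a ≡ false × b ≡ false
∨-false {false} e = refl , e

true≢false : ∀ {a} → a ≡ true → a ≢ false
true≢false = not-¬

true⇔⇒≡ : ∀ {a b} → (a ≡ true → b ≡ true) → (b ≡ true → a ≡ true) → a ≡ b
true⇔⇒≡ {true} f g = sym (f refl)
true⇔⇒≡ {false} {true} f g = g refl
true⇔⇒≡ {false} {false} f g = refl

does-true⁻ : ∀ {A : Set} (a? : Dec A) → does a? ≡ true → A
does-true⁻ (yes a) _ = a

module _ {A : Set} where

  ∷-unique : {x : A} {xs : List (A)} → x ∉ xs → Unique xs → Unique (x ∷ xs)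
  ∷-unique x∉xs u = Allₚ.¬Any⇒All¬ _ x∉xs ∷ u

  unique-tail : {x : A} {xs : List (A)} → Unique (x ∷ xs) → Unique xs
  unique-tail (_ ∷ u) = u

  unique-length-mono : {xs ys : List (A)} → Unique xs → (∀ {z} → z ∈ xs → z ∈ ys) →
    length xs ≤ length ys
  unique-length-mono {[]} _ _ = z≤n
  unique-length-mono {x ∷ xs} {ys} u xs⊆ys with ∈-∃++ (xs⊆ys (here refl))
  ... | as , bs , refl = subst (suc (length xs) ≤_) (sym length-split)
      (s≤s (unique-length-mono (unique-tail u) xs⊆as++bs))
    where
      xs⊆as++bs : ∀ {z} → z ∈ xs → z ∈ as ++ bs
      xs⊆as++bs z∈xs with ∈-++⁻ as (xs⊆ys (there z∈xs))
      ... | inj₁ p = ∈-++⁺ˡ p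
      ... | inj₂ (here refl) = ⊥-elim (Unique[x∷xs]⇒x∉xs u z∈xs)
      ... | inj₂ (there p) = ∈-++⁺ʳ as p
      length-split : length (as ++ x ∷ bs) ≡ suc (length (as ++ bs))
      length-split = begin
        length (as ++ x ∷ bs)        ≡⟨ length-++ as ⟩
        length as + suc (length bs)  ≡⟨ +-suc (length as) (length bs) ⟩
        suc (length as + length bs)  ≡⟨ cong suc (length-++ as) ⟨
        suc (length (as ++ bs))      ∎
        where open ≡-Reasoning

  ∈-filterᵇ⁺ : (P : A → Bool) {xs : List (A)} {z : A} → z ∈ xs → P z ≡ true → z ∈ filterᵇ P xs
  ∈-filterᵇ⁺ P z∈xs pz = ∈-filter⁺ (T? ∘ P) z∈xs (Equivalence.from T-≡ pz)

  ∈-filterᵇ⁻ : (P : A → Bool) (xs : List (A)) {z : A} → z ∈ filterᵇ P xs → P z ≡ true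
  ∈-filterᵇ⁻ P xs m = Equivalence.to T-≡ (proj₂ (∈-filter⁻ (T? ∘ P) {xs = xs} m))

  ∈-take⁻ : {w : A} (k : ℕ) (xs : List A) → w ∈ take k xs → w ∈ xs
  ∈-take⁻ (suc k) (x ∷ xs) (here e) = here e
  ∈-take⁻ (suc k) (x ∷ xs) (there m) = there (∈-take⁻ k xs m)

module _ {n : ℕ} where

  ≡ᵇ-≡ : {u v : Fin n} → (u ≡ᵇ v) ≡ true → u ≡ v
  ≡ᵇ-≡ {u} {v} = does-true⁻ (u ≟ᶠ v)

  ≡ᵇ-refl : (u : Fin n) → (u ≡ᵇ u) ≡ true
  ≡ᵇ-refl u = dec-true (u ≟ᶠ u) refl

  ≢-≡ᵇ : {u v : Fin n} → u ≢ v → (u ≡ᵇ v) ≡ false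
  ≢-≡ᵇ {u} {v} = dec-false (u ≟ᶠ v)

  ≡ᵇ-false⇒≢ : {u v : Fin n} → (u ≡ᵇ v) ≡ false → u ≢ v
  ≡ᵇ-false⇒≢ {u} e refl = true≢false (≡ᵇ-refl u) e

  ≡ᵇ-sym : (u v : Fin n) → (u ≡ᵇ v) ≡ (v ≡ᵇ u)
  ≡ᵇ-sym u v = does-⇔ (mk⇔ sym sym) (u ≟ᶠ v) (v ≟ᶠ u)

  elements : VSet n → List (Fin n)
  elements P = filterᵇ P (allFin n)

  elements-unique : (P : VSet n) → Unique (elements P)
  elements-unique P = filter⁺ (T? ∘ P) (allFin⁺ n)

  ∈-elements⁺ : (P : VSet n) {z : Fin n} → P z ≡ true → z ∈ elements P
  ∈-elements⁺ P {z} = ∈-filterᵇ⁺ P (∈-allFin z)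

  ∈-elements⁻ : (P : VSet n) {z : Fin n} → z ∈ elements P → P z ≡ true
  ∈-elements⁻ P = ∈-filterᵇ⁻ P (allFin n)

  length≡card : (P : VSet n) (xs : List (Fin n)) → Unique xs →
    (∀ {z} → z ∈ xs → P z ≡ true) → (∀ {z} → P z ≡ true → z ∈ xs) → length xs ≡ card P
  length≡card P xs u xs⊆P P⊆xs = ≤-antisym
    (unique-length-mono u (∈-elements⁺ P ∘ xs⊆P))
    (unique-length-mono (elements-unique P) (P⊆xs ∘ ∈-elements⁻ P))

  card-ext : (P Q : VSet n) → (∀ z → P z ≡ Q z) → card P ≡ card Q
  card-ext P Q P≗Q = cong length
    (filter-≐ (T? ∘ P) (T? ∘ Q) (subst T (P≗Q _) , subst T (sym (P≗Q _))) (allFin n))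

  _without_ : VSet n → Fin n → VSet n
  (P without x) z = P z ∧ not (z ≡ᵇ x)

  without-⊆ : ∀ P x {z} → (P without x) z ≡ true → P z ≡ true × z ≢ x
  without-⊆ P x {z} e = ∧-elimˡ {P z} e , ≡ᵇ-false⇒≢ (not-injective (∧-elimʳ {P z} e))

  ∈-without : ∀ P x {z} → P z ≡ true → z ≢ x → (P without x) z ≡ true
  ∈-without P x p z≢x = ∧-intro p (cong not (≢-≡ᵇ z≢x))

  card-without : (P : VSet n) (x : Fin n) → P x ≡ true → card P ≡ suc (card (P without x))
  card-without P x px = sym (length≡card P (x ∷ elements (P without x))
      (∷-unique (λ m → proj₂ (without-⊆ P x (∈-elements⁻ _ m)) refl) (elements-unique _)) ⊆P P⊆)
    where
      ⊆P : ∀ {z} → z ∈ x ∷ elements (P without x) → P z ≡ true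
      ⊆P (here refl) = px
      ⊆P (there m) = proj₁ (without-⊆ P x (∈-elements⁻ _ m))
      P⊆ : ∀ {z} → P z ≡ true → z ∈ x ∷ elements (P without x)
      P⊆ {z} pz with z ≟ᶠ x
      ... | yes refl = here refl
      ... | no z≢x = there (∈-elements⁺ _ (∈-without P x pz z≢x))

  card-empty : (P : VSet n) → (∀ z → P z ≡ false) → card P ≡ 0
  card-empty P none = sym (length≡card P [] [] (λ ()) (λ {z} pz → ⊥-elim (true≢false pz (none z))))

  witness-or-empty : (P : VSet n) → (∃ λ z → P z ≡ true) ⊎ (∀ z → P z ≡ false)
  witness-or-empty P with elements P in eq
  ... | [] = inj₂ (λ z → ¬-not (λ pz → absurd (subst (z ∈_) eq (∈-elements⁺ P pz))))
    where absurd : ∀ {z : Fin n} → z ∉ []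
          absurd ()
  ... | z ∷ _ = inj₁ (z , ∈-elements⁻ P (subst (z ∈_) (sym eq) (here refl)))

  card>0⇒witness : (P : VSet n) → 0 < card P → ∃ λ z → P z ≡ true
  card>0⇒witness P 0<card with witness-or-empty P
  ... | inj₁ w = w
  ... | inj₂ none = ⊥-elim (<-irrefl (sym (card-empty P none)) 0<card)

  card-singleton : (x : Fin n) → card (_≡ᵇ x) ≡ 1
  card-singleton x = trans (card-without _ x (≡ᵇ-refl x)) (cong suc (card-empty _ only-x))
    where only-x : ∀ z → ((_≡ᵇ x) without x) z ≡ false
          only-x z with z ≡ᵇ x
          ... | true = refl
          ... | false = refl

  card-∨ : (A B : VSet n) → (∀ z → A z ≡ true → B z ≢ true) →
    card (λ z → A z ∨ B z) ≡ card A + card B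
  card-∨ A B disjoint = begin
    card (λ z → A z ∨ B z)            ≡⟨ length≡card _ (elements A ++ elements B) unique ⊆A∨B A∨B⊆ ⟨
    length (elements A ++ elements B) ≡⟨ length-++ (elements A) ⟩
    card A + card B                   ∎
    where
      open ≡-Reasoning
      unique : Unique (elements A ++ elements B)
      unique = ++⁺ (elements-unique A) (elements-unique B)
        (λ (a , b) → disjoint _ (∈-elements⁻ A a) (∈-elements⁻ B b))
      ⊆A∨B : ∀ {z} → z ∈ elements A ++ elements B → A z ∨ B z ≡ true
      ⊆A∨B {z} m with ∈-++⁻ (elements A) m
      ... | inj₁ p = ∨-introˡ (B z) (∈-elements⁻ A p)
      ... | inj₂ p = ∨-introʳ (A z) (∈-elements⁻ B p)
      A∨B⊆ : ∀ {z} → A z ∨ B z ≡ true → z ∈ elements A ++ elements B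
      A∨B⊆ e with ∨-elim e
      ... | inj₁ p = ∈-++⁺ˡ (∈-elements⁺ A p)
      ... | inj₂ p = ∈-++⁺ʳ (elements A) (∈-elements⁺ B p)

  card-full : card (λ (_ : Fin n) → true) ≡ n
  card-full = trans (sym (length≡card _ (allFin n) (allFin⁺ n) (λ _ → refl) (λ {z} _ → ∈-allFin z)))
                    (length-tabulate {n = n} (λ i → i))

  card+card-not : (A : VSet n) → card A + card (not ∘ A) ≡ n
  card+card-not A = begin
    card A + card (not ∘ A)        ≡⟨ card-∨ A (not ∘ A) (λ z a nb → true≢false a (not-injective nb)) ⟨
    card (λ z → A z ∨ not (A z))   ≡⟨ card-ext _ _ (λ z → ∨-inverseʳ (A z)) ⟩
    card (λ (_ : Fin n) → true)    ≡⟨ card-full ⟩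
    n                              ∎
    where open ≡-Reasoning

  card-split : (A B : VSet n) → card A ≡ card (λ z → A z ∧ B z) + card (λ z → A z ∧ not (B z))
  card-split A B = trans (card-ext _ _ A≗) (card-∨ _ _ disjoint)
    where
      A≗ : ∀ z → A z ≡ ((A z ∧ B z) ∨ (A z ∧ not (B z)))
      A≗ z with A z | B z
      ... | true | true = refl
      ... | true | false = refl
      ... | false | _ = refl
      disjoint : ∀ z → A z ∧ B z ≡ true → A z ∧ not (B z) ≢ true
      disjoint z p q = true≢false (∧-elimʳ {A z} p) (not-injective (∧-elimʳ {A z} q))

  card-injection : (A B : VSet n) (f : Fin n → Fin n) → (∀ x → A x ≡ true → B (f x) ≡ true) →
    (∀ x y → A x ≡ true → A y ≡ true → f x ≡ f y → x ≡ y) → card A ≤ card B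
  card-injection A B f A→B injective =
    subst (_≤ card B) (length-map f (elements A))
      (unique-length-mono (map-unique (elements A) (elements-unique A) (∈-elements⁻ A)) image⊆B)
    where
      map-unique : (xs : List (Fin n)) → Unique xs → (∀ {z} → z ∈ xs → A z ≡ true) → Unique (map f xs)
      map-unique [] _ _ = []
      map-unique (x ∷ xs) u xs⊆A = ∷-unique fx∉ (map-unique xs (unique-tail u) (xs⊆A ∘ there))
        where fx∉ : f x ∉ map f xs
              fx∉ m with ∈-map⁻ f m
              ... | y , y∈xs , fx≡fy = Unique[x∷xs]⇒x∉xs u
                (subst (_∈ xs) (sym (injective x y (xs⊆A (here refl)) (xs⊆A (there y∈xs)) fx≡fy)) y∈xs)
      image⊆B : ∀ {z} → z ∈ map f (elements A) → z ∈ elements B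
      image⊆B m with ∈-map⁻ f m
      ... | y , y∈A , refl = ∈-elements⁺ B (A→B y (∈-elements⁻ A y∈A))

  card≤1 : (A : VSet n) → (∀ x y → A x ≡ true → A y ≡ true → x ≡ y) → card A ≤ 1
  card≤1 A atMostOne with witness-or-empty A
  ... | inj₂ none = subst (_≤ 1) (sym (card-empty A none)) z≤n
  ... | inj₁ (x , ax) = subst (card A ≤_) (card-singleton x)
    (card-injection A (_≡ᵇ x) (λ z → z)
      (λ z az → subst (λ w → (z ≡ᵇ w) ≡ true) (atMostOne z x az ax) (≡ᵇ-refl z)) (λ _ _ _ _ e → e))

Even : ℕ → Set
Even m = ∃ λ k → m ≡ 2 * k

Odd⇒¬Even : ∀ {n m} → Odd {n} m → ¬ Even m
Odd⇒¬Even (k , refl) (j , e) = even≢odd j k (sym e)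

Odd⇒¬Odd[1+m] : ∀ {n m} → Odd {n} m → ¬ Odd {n} (suc m)
Odd⇒¬Odd[1+m] {n} odd (j , e) = Odd⇒¬Even {n} odd (j , suc-injective e)

Odd[2+m]⇒Odd[m] : ∀ {n m} → Odd {n} (suc (suc m)) → Odd {n} m
Odd[2+m]⇒Odd[m] (zero , ())
Odd[2+m]⇒Odd[m] (suc k , e) = k , suc-injective (suc-injective (trans e (cong suc (*-suc 2 k))))

Odd[m]⇒Odd[2+m] : ∀ {n m} → Odd {n} m → Odd {n} (suc (suc m))
Odd[m]⇒Odd[2+m] (k , e) = suc k , trans (cong (suc ∘ suc) e) (cong suc (sym (*-suc 2 k)))

¬Odd[2] : ∀ {n} → ¬ Odd {n} 2
¬Odd[2] {n} odd = Odd⇒¬Odd[1+m] {n} (Odd[2+m]⇒Odd[m] {n} odd) (0 , refl)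

module _ {n : ℕ} where

  open import Data.List.Membership.DecPropositional (_≟ᶠ_ {n}) using (_∈?_)

  inList : List (Fin n) → VSet n
  inList xs w = does (w ∈? xs)

  inList⁺ : {xs : List (Fin n)} {w : Fin n} → w ∈ xs → inList xs w ≡ true
  inList⁺ {xs} {w} = dec-true (w ∈? xs)

  inList⁻ : {xs : List (Fin n)} {w : Fin n} → inList xs w ≡ true → w ∈ xs
  inList⁻ {xs} {w} = does-true⁻ (w ∈? xs)

  covered : Matching {n} → VSet n
  covered M = inList (endpoints M)

  covered⁺ : (M : Matching {n}) {w : Fin n} → w ∈ endpoints M → covered M w ≡ true
  covered⁺ M = inList⁺

  covered⁻ : (M : Matching {n}) {w : Fin n} → covered M w ≡ true → w ∈ endpoints M
  covered⁻ M = inList⁻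

  uncovered : Matching {n} → VSet n
  uncovered M = not ∘ covered M

  uncovered⇒∉ : (M : Matching {n}) {w : Fin n} → uncovered M w ≡ true → w ∉ endpoints M
  uncovered⇒∉ M u m = true≢false (inList⁺ m) (not-injective u)

  -- The partner of w in M, and w itself if w is uncovered.
  mate : Matching {n} → Fin n → Fin n
  mate [] w = w
  mate ((a , b) ∷ M) w = if w ≡ᵇ a then b else (if w ≡ᵇ b then a else mate M w)

  ∈-endpoints : (M : Matching {n}) {a b : Fin n} → (a , b) ∈ M → a ∈ endpoints M × b ∈ endpoints M
  ∈-endpoints ((a , b) ∷ M) (here refl) = here refl , there (here refl)
  ∈-endpoints ((c , d) ∷ M) (there m) =
    let (a∈ , b∈) = ∈-endpoints M m in there (there a∈) , there (there b∈)

  mate-∷-other : (M : Matching {n}) (a b w : Fin n) → w ≢ a → w ≢ b → mate ((a , b) ∷ M) w ≡ mate M w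
  mate-∷-other M a b w w≢a w≢b rewrite ≢-≡ᵇ w≢a | ≢-≡ᵇ w≢b = refl

  mate-edge : (M : Matching {n}) → Unique (endpoints M) → {a b : Fin n} → (a , b) ∈ M →
    mate M a ≡ b × mate M b ≡ a
  mate-edge ((a , b) ∷ M) u (here refl)
    rewrite ≡ᵇ-refl a | ≢-≡ᵇ (λ (b≡a : b ≡ a) → Unique[x∷xs]⇒x∉xs u (here (sym b≡a))) | ≡ᵇ-refl b
    = refl , refl
  mate-edge ((c , d) ∷ M) u {a} {b} (there m) =
    trans (mate-∷-other M c d a (≢c a∈) (≢d a∈)) ih₁ , trans (mate-∷-other M c d b (≢c b∈) (≢d b∈)) ih₂
    where
      a∈ = proj₁ (∈-endpoints M m)
      b∈ = proj₂ (∈-endpoints M m)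
      ih₁ = proj₁ (mate-edge M (unique-tail (unique-tail u)) m)
      ih₂ = proj₂ (mate-edge M (unique-tail (unique-tail u)) m)
      ≢c : ∀ {w} → w ∈ endpoints M → w ≢ c
      ≢c w∈ refl = Unique[x∷xs]⇒x∉xs u (there w∈)
      ≢d : ∀ {w} → w ∈ endpoints M → w ≢ d
      ≢d w∈ refl = Unique[x∷xs]⇒x∉xs (unique-tail u) w∈

  edge-at : (M : Matching {n}) {w : Fin n} → w ∈ endpoints M → ∃ λ p → (w , p) ∈ M ⊎ (p , w) ∈ M
  edge-at ((a , b) ∷ M) (here refl) = b , inj₁ (here refl)
  edge-at ((a , b) ∷ M) (there (here refl)) = a , inj₂ (here refl)
  edge-at ((a , b) ∷ M) (there (there m)) with edge-at M m
  ... | p , inj₁ e = p , inj₁ (there e)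
  ... | p , inj₂ e = p , inj₂ (there e)

  edge-to-mate : (M : Matching {n}) → Unique (endpoints M) → {w : Fin n} → w ∈ endpoints M →
    ((w , mate M w) ∈ M ⊎ (mate M w , w) ∈ M) × mate M (mate M w) ≡ w
  edge-to-mate M u w∈ with edge-at M w∈
  ... | p , inj₁ e = let (e₁ , e₂) = mate-edge M u e in
    inj₁ (subst (λ z → (_ , z) ∈ M) (sym e₁) e) , trans (cong (mate M) e₁) e₂
  ... | p , inj₂ e = let (e₁ , e₂) = mate-edge M u e in
    inj₂ (subst (λ z → (z , _) ∈ M) (sym e₂) e) , trans (cong (mate M) e₂) e₁

  mate-injective : (M : Matching {n}) → Unique (endpoints M) → {w w′ : Fin n} →
    w ∈ endpoints M → w′ ∈ endpoints M → mate M w ≡ mate M w′ → w ≡ w′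
  mate-injective M u w∈ w′∈ e =
    trans (sym (proj₂ (edge-to-mate M u w∈))) (trans (cong (mate M) e) (proj₂ (edge-to-mate M u w′∈)))

  mate-∈-endpoints : (M : Matching {n}) → Unique (endpoints M) → {w : Fin n} → w ∈ endpoints M →
    mate M w ∈ endpoints M
  mate-∈-endpoints M u w∈ with proj₁ (edge-to-mate M u w∈)
  ... | inj₁ e = proj₂ (∈-endpoints M e)
  ... | inj₂ e = proj₁ (∈-endpoints M e)

  mate-adjacent : (H : Graph n) → (∀ u v → H u v ≡ H v u) → (M : Matching {n}) → IsMatching H M →
    {w : Fin n} → w ∈ endpoints M → H w (mate M w) ≡ true
  mate-adjacent H Hsym M (edges , u) w∈ with proj₁ (edge-to-mate M u w∈)
  ... | inj₁ e = All.lookup edges e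
  ... | inj₂ e = trans (Hsym _ _) (All.lookup edges e)

  length-endpoints : (M : Matching {n}) → length (endpoints M) ≡ 2 * length M
  length-endpoints [] = refl
  length-endpoints ((a , b) ∷ M) =
    trans (cong (suc ∘ suc) (length-endpoints M)) (cong suc (sym (+-suc (length M) (length M + 0))))

  card-covered : (M : Matching {n}) → Unique (endpoints M) → card (covered M) ≡ 2 * length M
  card-covered M u = trans (sym (length≡card (covered M) (endpoints M) u inList⁺ inList⁻)) (length-endpoints M)

  size+uncovered : (M : Matching {n}) → Unique (endpoints M) → 2 * length M + card (uncovered M) ≡ n
  size+uncovered M u =
    trans (cong (_+ card (uncovered M)) (sym (card-covered M u))) (card+card-not (covered M))

  size-anti-uncovered : (M M′ : Matching {n}) → Unique (endpoints M) → Unique (endpoints M′) →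
    card (uncovered M) ≤ card (uncovered M′) → length M′ ≤ length M
  size-anti-uncovered M M′ u u′ fewer = *-cancelˡ-≤ 2 (+-cancelʳ-≤ (card (uncovered M′)) _ _
    (subst (_≤ 2 * length M + card (uncovered M′)) (trans (size+uncovered M u) (sym (size+uncovered M′ u′)))
      (+-monoʳ-≤ (2 * length M) fewer)))

  uncovered-anti-size : (M M′ : Matching {n}) → Unique (endpoints M) → Unique (endpoints M′) →
    length M′ ≤ length M → card (uncovered M) ≤ card (uncovered M′)
  uncovered-anti-size M M′ u u′ smaller = +-cancelˡ-≤ (2 * length M) _ _
    (subst (_≤ 2 * length M + card (uncovered M′)) (trans (size+uncovered M′ u′) (sym (size+uncovered M u)))
      (+-monoˡ-≤ (card (uncovered M′)) (*-monoʳ-≤ 2 smaller)))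

  endpoints-in-even : (C : VSet n) (M : Matching {n}) → All (λ (a , b) → C a ≡ C b) M →
    Even (length (filterᵇ C (endpoints M)))
  endpoints-in-even C [] [] = 0 , refl
  endpoints-in-even C ((a , b) ∷ M) (Ca≡Cb ∷ rest) with C a in Ca | endpoints-in-even C M rest
  ... | true | k , ih rewrite sym Ca≡Cb =
    suc k , trans (cong (suc ∘ suc) ih) (cong suc (sym (+-suc k (k + 0))))
  ... | false | ih rewrite sym Ca≡Cb = ih

  odd-set-meets-exposed : (H : Graph n) → (∀ u v → H u v ≡ H v u) → (X C : VSet n) → Odd {n} (card C) →
    (∀ a b → C a ≡ true → X b ≡ false → H a b ≡ true → C b ≡ true) →
    (M : Matching {n}) → IsMatching H M →
    ∃ λ w → C w ∧ (uncovered M w ∨ X (mate M w)) ≡ true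
  odd-set-meets-exposed H Hsym X C odd C-closed M (edges , u)
    with witness-or-empty (λ w → C w ∧ (uncovered M w ∨ X (mate M w)))
  ... | inj₁ w = w
  ... | inj₂ none = ⊥-elim (Odd⇒¬Even {n} odd (subst Even (sym card≡) (endpoints-in-even C M M-inside)))
    where
      matched-inside : ∀ {w} → C w ≡ true → covered M w ≡ true × X (mate M w) ≡ false
      matched-inside {w} Cw with ∨-false (subst (λ c → c ∧ (uncovered M w ∨ X (mate M w)) ≡ false) Cw (none w))
      ... | unc , Xm = not-injective unc , Xm
      along : ∀ {a b} → mate M a ≡ b → H a b ≡ true → C a ≡ true → C b ≡ true
      along {a} refl Hab Ca = C-closed a _ Ca (proj₂ (matched-inside Ca)) Hab
      M-inside : All (λ (a , b) → C a ≡ C b) M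
      M-inside = All.tabulate λ { {a , b} e → let Hab = All.lookup edges e in
        true⇔⇒≡ (along (proj₁ (mate-edge M u e)) Hab) (along (proj₂ (mate-edge M u e)) (trans (Hsym b a) Hab)) }
      card≡ : card C ≡ length (filterᵇ C (endpoints M))
      card≡ = sym (length≡card C _ (filter⁺ (T? ∘ C) u) (∈-filterᵇ⁻ C (endpoints M))
        (λ Cz → ∈-filterᵇ⁺ C (covered⁻ M (proj₁ (matched-inside Cz))) Cz))

-- Tutte–Berge: removing X leaves the R-classes as odd components, each of which
-- contains a vertex that M leaves exposed or matches into X.
module Deficiency {n : ℕ} (H : Graph n) (H-sym : ∀ u v → H u v ≡ H v u) (X : VSet n)
  (R : Fin n → Fin n → Bool)
  (R-sym : ∀ u v → R u v ≡ true → R v u ≡ true)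
  (R-trans : ∀ u v w → R u v ≡ true → R v w ≡ true → R u w ≡ true)
  (R-avoids-X : ∀ u w → X u ≡ false → R u w ≡ true → X w ≡ false)
  (R-odd : ∀ u → X u ≡ false → Odd {n} (card (R u)))
  (edge⇒R : ∀ u w → X u ≡ false → X w ≡ false → H u w ≡ true → R u w ≡ true)
  (M : Matching {n}) (M-matching : IsMatching H M)
  where

  exposed matched-out : VSet n
  exposed w = not (X w) ∧ uncovered M w
  matched-out w = not (X w) ∧ (covered M w ∧ X (mate M w))

  represents : Fin n → Fin n → Set
  represents u w = R u w ∧ (exposed w ∨ matched-out w) ≡ true

  representative : ∀ u → X u ≡ false → ∃ (represents u)
  representative u Xu with odd-set-meets-exposed H H-sym X (R u) (R-odd u Xu) R-closed M M-matching
    where R-closed : ∀ a b → R u a ≡ true → X b ≡ false → H a b ≡ true → R u b ≡ true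
          R-closed a b Rua Xb Hab = R-trans u a b Rua (edge⇒R a b (R-avoids-X u a Xu Rua) Xb Hab)
  ... | w , e = w , ∧-intro Ruw (sort (covered M w) refl (∧-elimʳ {R u w} e))
    where
      Ruw = ∧-elimˡ {R u w} e
      notX = cong not (R-avoids-X u w Xu Ruw)
      sort : ∀ c → covered M w ≡ c → not c ∨ X (mate M w) ≡ true → exposed w ∨ matched-out w ≡ true
      sort false c _ = ∨-introˡ (matched-out w) (∧-intro notX (cong not c))
      sort true c Xm = ∨-introʳ (exposed w) (∧-intro notX (∧-intro c Xm))

  -- Extended by the identity on X to a total function, as card-injection requires.
  pick-by : ∀ u b → X u ≡ b → Fin n
  pick-by u false Xu = proj₁ (representative u Xu)
  pick-by u true _ = u

  pick : Fin n → Fin n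
  pick u = pick-by u (X u) refl

  pick-represents : ∀ u → X u ≡ false → represents u (pick u)
  pick-represents u = by (X u) refl
    where by : ∀ b (Xu : X u ≡ b) → b ≡ false → represents u (pick-by u b Xu)
          by false Xu _ = proj₂ (representative u Xu)

  card-matched-out : card matched-out ≤ card (λ w → X w ∧ covered M w)
  card-matched-out = card-injection matched-out _ (mate M)
      (λ w m → ∧-intro (∧-elimʳ {covered M w} (∧-elimʳ {not (X w)} m))
                       (covered⁺ M (mate-∈-endpoints M (proj₂ M-matching) (matched w m))))
      (λ w w′ m m′ → mate-injective M (proj₂ M-matching) (matched w m) (matched w′ m′))
    where matched : ∀ w → matched-out w ≡ true → w ∈ endpoints M
          matched w m = covered⁻ M (∧-elimˡ {covered M w} (∧-elimʳ {not (X w)} m))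

  deficiency-bound : (T : VSet n) → (∀ t → T t ≡ true → X t ≡ false) →
    (∀ t t′ → T t ≡ true → T t′ ≡ true → R t t′ ≡ true → t ≡ t′) →
    card T + 2 * card (λ w → X w ∧ uncovered M w) ≤ card (uncovered M) + card X
  deficiency-bound T T-avoids-X T-transversal = begin
    card T + 2 * x-unc                           ≤⟨ +-monoˡ-≤ (2 * x-unc) T≤ ⟩
    card exposed + card matched-out + 2 * x-unc  ≤⟨ +-monoˡ-≤ (2 * x-unc)
                                                      (+-monoʳ-≤ (card exposed) card-matched-out) ⟩
    card exposed + x-cov + 2 * x-unc             ≡⟨ regroup (card exposed) x-cov x-unc ⟩
    (x-unc + card exposed) + (x-cov + x-unc)     ≡⟨ cong₂ _+_ uncovered-split X-split ⟨
    card (uncovered M) + card X                  ∎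
    where
      open ≤-Reasoning
      x-cov = card (λ w → X w ∧ covered M w)
      x-unc = card (λ w → X w ∧ uncovered M w)
      regroup : ∀ e c u → e + c + 2 * u ≡ (u + e) + (c + u)
      regroup = solve-∀
      X-split : card X ≡ x-cov + x-unc
      X-split = card-split X (covered M)
      uncovered-split : card (uncovered M) ≡ x-unc + card exposed
      uncovered-split = trans (card-split (uncovered M) X)
        (cong₂ _+_ (card-ext _ _ (λ w → ∧-comm (uncovered M w) (X w)))
                   (card-ext _ _ (λ w → ∧-comm (uncovered M w) (not (X w)))))
      T≤ : card T ≤ card exposed + card matched-out
      T≤ = subst (card T ≤_) (card-∨ exposed matched-out disjoint) (card-injection T _ pick
        (λ t Tt → ∧-elimʳ {R t (pick t)} (pick-represents t (T-avoids-X t Tt)))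
        (λ t t′ Tt Tt′ same → T-transversal t t′ Tt Tt′
          (R-trans t (pick t) t′ (∧-elimˡ (pick-represents t (T-avoids-X t Tt)))
            (R-sym t′ (pick t) (subst (λ z → R t′ z ≡ true) (sym same)
              (∧-elimˡ (pick-represents t′ (T-avoids-X t′ Tt′))))))))
        where disjoint : ∀ z → exposed z ≡ true → matched-out z ≢ true
              disjoint z e m = true≢false (∧-elimˡ {covered M z} (∧-elimʳ {not (X z)} m))
                                          (not-injective (∧-elimʳ {not (X z)} e))

module NearPerfectMatching {n : ℕ} (H : Graph n) (R : Fin n → Fin n → Bool)
  (R-refl : ∀ u → R u u ≡ true)
  (R-sym : ∀ u v → R u v ≡ true → R v u ≡ true)
  (R-trans : ∀ u v w → R u v ≡ true → R v w ≡ true → R u w ≡ true)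
  (R⇒H : ∀ a b → R a b ≡ true → a ≢ b → H a b ≡ true)
  where

  classIn : VSet n → Fin n → VSet n
  classIn P w z = R w z ∧ P z

  record NearPerfect (P : VSet n) (v : Fin n) (M : Matching {n}) : Set where
    field
      matching : IsMatching H M
      inside : ∀ {w} → w ∈ endpoints M → P w ≡ true
      avoids : v ∉ endpoints M
      exposed-odd : ∀ {w} → P w ≡ true → w ∉ endpoints M → Odd {n} (card (classIn P w))
      exposed-alone : ∀ {w w′} → P w ≡ true → P w′ ≡ true → R w w′ ≡ true →
        w ∉ endpoints M → w′ ∉ endpoints M → w′ ≡ w

  OddAt : VSet n → Fin n → Set
  OddAt P v = P v ≡ true → Odd {n} (card (classIn P v))

  card-classIn-without : ∀ P x w → P x ≡ true → R w x ≡ true →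
    card (classIn P w) ≡ suc (card (classIn (P without x) w))
  card-classIn-without P x w Px Rwx = trans (card-without (classIn P w) x (∧-intro Rwx Px))
    (cong suc (card-ext _ _ (λ z → ∧-assoc (R w z) (P z) (not (z ≡ᵇ x)))))

  card-classIn-without-other : ∀ P x w → R w x ≡ false →
    card (classIn (P without x) w) ≡ card (classIn P w)
  card-classIn-without-other P x w Rwx = card-ext _ _ same
    where same : ∀ z → classIn (P without x) w z ≡ classIn P w z
          same z with z ≟ᶠ x
          ... | yes refl rewrite Rwx = refl
          ... | no _ = cong (R w z ∧_) (∧-identityʳ (P z))

  near-perfect-empty : (P : VSet n) (v : Fin n) → OddAt P v → (∀ z → (P without v) z ≡ false) →
    NearPerfect P v []
  near-perfect-empty P v odd only-v = record
    { matching = [] , []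
    ; inside = λ ()
    ; avoids = λ ()
    ; exposed-odd = λ Pw _ → subst (λ z → Odd {n} (card (classIn P z))) (sym (is-v Pw))
                                (odd (subst (λ z → P z ≡ true) (is-v Pw) Pw))
    ; exposed-alone = λ Pw Pw′ _ _ _ → trans (is-v Pw′) (sym (is-v Pw))
    }
    where is-v : ∀ {w} → P w ≡ true → w ≡ v
          is-v {w} Pw with w ≟ᶠ v
          ... | yes w≡v = w≡v
          ... | no w≢v = ⊥-elim (true≢false (∈-without P v Pw w≢v) (only-v w))

  module Pair (P : VSet n) (v x y : Fin n) (Px : P x ≡ true) (Py : P y ≡ true)
    (x≢y : x ≢ y) (x≢v : x ≢ v) (y≢v : y ≢ v) (Rxy : R x y ≡ true) where

    P′ : VSet n
    P′ = (P without x) without y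

    P′⊆ : ∀ {z} → P′ z ≡ true → P z ≡ true × z ≢ x × z ≢ y
    P′⊆ e = let (Pxz , z≢y) = without-⊆ (P without x) y e ; (Pz , z≢x) = without-⊆ P x Pxz in Pz , z≢x , z≢y

    ∈P′ : ∀ {z} → P z ≡ true → z ≢ x → z ≢ y → P′ z ≡ true
    ∈P′ Pz z≢x z≢y = ∈-without (P without x) y (∈-without P x Pz z≢x) z≢y

    class-shrinks : ∀ w → card (classIn P w) ≡ suc (suc (card (classIn P′ w)))
                        ⊎ card (classIn P w) ≡ card (classIn P′ w)
    class-shrinks w with R w x in Rwx
    ... | true = inj₁ (trans (card-classIn-without P x w Px Rwx)
      (cong suc (card-classIn-without (P without x) y w (∈-without P x Py (x≢y ∘ sym)) (R-trans w x y Rwx Rxy))))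
    ... | false = inj₂ (sym (trans (card-classIn-without-other (P without x) y w Rwy) (card-classIn-without-other P x w Rwx)))
      where Rwy : R w y ≡ false
            Rwy = ¬-not (λ Rwy → true≢false (R-trans w y x Rwy (R-sym x y Rxy)) Rwx)

    odd-shrinks : ∀ w → Odd {n} (card (classIn P w)) → Odd {n} (card (classIn P′ w))
    odd-shrinks w odd with class-shrinks w
    ... | inj₁ e = Odd[2+m]⇒Odd[m] {n} (subst (Odd {n}) e odd)
    ... | inj₂ e = subst (Odd {n}) e odd

    odd-grows : ∀ w → Odd {n} (card (classIn P′ w)) → Odd {n} (card (classIn P w))
    odd-grows w odd with class-shrinks w
    ... | inj₁ e = subst (Odd {n}) (sym e) (Odd[m]⇒Odd[2+m] {n} odd)
    ... | inj₂ e = subst (Odd {n}) (sym e) odd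

    OddAt-shrinks : OddAt P v → OddAt P′ v
    OddAt-shrinks odd P′v = odd-shrinks v (odd (proj₁ (P′⊆ P′v)))

    add-pair : ∀ {M} → NearPerfect P′ v M → NearPerfect P v ((x , y) ∷ M)
    add-pair {M} np = record
      { matching = R⇒H x y Rxy x≢y ∷ proj₁ matching , ∷-unique x∉ (∷-unique y∉ (proj₂ matching))
      ; inside = λ { (here refl) → Px ; (there (here refl)) → Py ; (there (there m)) → proj₁ (P′⊆ (inside m)) }
      ; avoids = λ { (here v≡x) → x≢v (sym v≡x)
                   ; (there (here v≡y)) → y≢v (sym v≡y)
                   ; (there (there m)) → avoids m }
      ; exposed-odd = λ Pw w∉ → odd-grows _ (exposed-odd (in-P′ Pw w∉) (w∉ ∘ there ∘ there))
      ; exposed-alone = λ Pw Pw′ Rww′ w∉ w′∉ → exposed-alone (in-P′ Pw w∉) (in-P′ Pw′ w′∉) Rww′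
                                                             (w∉ ∘ there ∘ there) (w′∉ ∘ there ∘ there)
      }
      where
        open NearPerfect np
        x∉ : x ∉ y ∷ endpoints M
        x∉ (here x≡y) = x≢y x≡y
        x∉ (there m) = proj₁ (proj₂ (P′⊆ (inside m))) refl
        y∉ : y ∉ endpoints M
        y∉ m = proj₂ (proj₂ (P′⊆ (inside m))) refl
        in-P′ : ∀ {w} → P w ≡ true → w ∉ endpoints ((x , y) ∷ M) → P′ w ≡ true
        in-P′ Pw w∉ = ∈P′ Pw (λ w≡x → w∉ (here w≡x)) (λ w≡y → w∉ (there (here w≡y)))

  module Single (P : VSet n) (v x : Fin n) (Px : P x ≡ true) (x≢v : x ≢ v)
    (alone : ∀ z → R x z ≡ true → P z ≡ true → z ≡ x) where

    unrelated : ∀ w → P w ≡ true → w ≢ x → R w x ≡ false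
    unrelated w Pw w≢x = ¬-not (λ Rwx → w≢x (alone w (R-sym w x Rwx) Pw))

    OddAt-shrinks : OddAt P v → OddAt (P without x) v
    OddAt-shrinks odd Pv′ = let (Pv , v≢x) = without-⊆ P x Pv′ in
      subst (Odd {n}) (sym (card-classIn-without-other P x v (unrelated v Pv v≢x))) (odd Pv)

    card-class-x : card (classIn P x) ≡ 1
    card-class-x = trans (card-classIn-without P x x Px (R-refl x)) (cong suc (card-empty _ nothing-else))
      where nothing-else : ∀ z → classIn (P without x) x z ≡ false
            nothing-else z = ¬-not λ e → let (Pz , z≢x) = without-⊆ P x (∧-elimʳ {R x z} e) in
              z≢x (alone z (∧-elimˡ {R x z} e) Pz)

    leave-exposed : ∀ {M} → NearPerfect (P without x) v M → NearPerfect P v M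
    leave-exposed {M} np = record
      { matching = matching
      ; inside = λ m → proj₁ (without-⊆ P x (inside m))
      ; avoids = avoids
      ; exposed-odd = odd
      ; exposed-alone = only
      }
      where
        open NearPerfect np
        odd : ∀ {w} → P w ≡ true → w ∉ endpoints M → Odd {n} (card (classIn P w))
        odd {w} Pw w∉ with w ≟ᶠ x
        ... | yes refl = 0 , card-class-x
        ... | no w≢x = subst (Odd {n}) (card-classIn-without-other P x w (unrelated w Pw w≢x))
                         (exposed-odd (∈-without P x Pw w≢x) w∉)
        only : ∀ {w w′} → P w ≡ true → P w′ ≡ true → R w w′ ≡ true →
          w ∉ endpoints M → w′ ∉ endpoints M → w′ ≡ w
        only {w} {w′} Pw Pw′ Rww′ w∉ w′∉ with w ≟ᶠ x | w′ ≟ᶠ x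
        ... | yes refl | _ = alone w′ Rww′ Pw′
        ... | no w≢x | yes refl = ⊥-elim (true≢false Rww′ (unrelated w Pw w≢x))
        ... | no w≢x | no w′≢x =
          exposed-alone (∈-without P x Pw w≢x) (∈-without P x Pw′ w′≢x) Rww′ w∉ w′∉

  partners : VSet n → Fin n → Fin n → VSet n
  partners P v x = (classIn P x without x) without v

  partners⁺ : ∀ P v x z → R x z ≡ true → P z ≡ true → z ≢ x → z ≢ v → partners P v x z ≡ true
  partners⁺ P v x z Rxz Pz z≢x z≢v =
    ∈-without (classIn P x without x) v (∈-without (classIn P x) x (∧-intro Rxz Pz) z≢x) z≢v

  partners⁻ : ∀ P v x z → partners P v x z ≡ true → R x z ≡ true × P z ≡ true × z ≢ x × z ≢ v
  partners⁻ P v x z e =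
    let (e′ , z≢v) = without-⊆ (classIn P x without x) v e ; (e″ , z≢x) = without-⊆ (classIn P x) x e′ in
    ∧-elimˡ {R x z} e″ , ∧-elimʳ {R x z} e″ , z≢x , z≢v

  partnerless-class : ∀ P v x → P x ≡ true → x ≢ v → (∀ z → partners P v x z ≡ false) →
    R x v ≡ true → P v ≡ true → card (classIn P v) ≡ 2
  partnerless-class P v x Px x≢v none Rxv Pv =
    trans (card-classIn-without P v v Pv (R-refl v))
      (cong suc (trans (card-classIn-without (P without v) x v (∈-without P v Px x≢v) (R-sym x v Rxv))
        (cong suc (card-empty _ nothing-else))))
    where
      nothing-else : ∀ z → classIn ((P without v) without x) v z ≡ false
      nothing-else z = ¬-not λ e →
        let (Pvz , z≢x) = without-⊆ (P without v) x (∧-elimʳ {R v z} e) ; (Pz , z≢v) = without-⊆ P v Pvz in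
        true≢false (partners⁺ P v x z (R-trans x v z Rxv (∧-elimˡ {R v z} e)) Pz z≢x z≢v) (none z)

  near-perfect-bounded : ∀ m (P : VSet n) → card P ≤ m → (v : Fin n) → OddAt P v →
    Σ (Matching {n}) (NearPerfect P v)
  near-perfect-from : ∀ m (P : VSet n) → card P ≤ m → (v : Fin n) → OddAt P v →
    (x : Fin n) → P x ≡ true → x ≢ v → Σ (Matching {n}) (NearPerfect P v)

  -- Take x ≠ v in P. If its class in P has another vertex y ≠ v, match x with y; otherwise
  -- the class is {x} (it cannot be {x , v}, which is even) and x stays exposed.
  near-perfect-bounded m P P≤m v odd with witness-or-empty (P without v)
  ... | inj₂ only-v = [] , near-perfect-empty P v odd only-v
  ... | inj₁ (x , e) = let (Px , x≢v) = without-⊆ P v e in near-perfect-from m P P≤m v odd x Px x≢v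

  near-perfect-from zero P P≤0 v odd x Px x≢v with trans (sym (card-without P x Px)) (n≤0⇒n≡0 P≤0)
  ... | ()
  near-perfect-from (suc m) P P≤1+m v odd x Px x≢v with witness-or-empty (partners P v x)
  ... | inj₁ (y , e) =
    let (Rxy , Py , y≢x , y≢v) = partners⁻ P v x y e
        open Pair P v x y Px Py (y≢x ∘ sym) x≢v y≢v Rxy
        P′≤m : card P′ ≤ m
        P′≤m = ≤-trans (n≤1+n _) (≤-pred (subst (_≤ suc m) (trans (card-without P x Px)
                 (cong suc (card-without (P without x) y (∈-without P x Py y≢x)))) P≤1+m))
        (M , np) = near-perfect-bounded m P′ P′≤m v (OddAt-shrinks odd)
    in (x , y) ∷ M , add-pair np
  ... | inj₂ none with R x v ∧ P v in xv
  ...   | true = ⊥-elim (¬Odd[2] {n} (subst (Odd {n})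
                   (partnerless-class P v x Px x≢v none (∧-elimˡ {R x v} xv) (∧-elimʳ {R x v} xv))
                   (odd (∧-elimʳ {R x v} xv))))
  ...   | false =
    let open Single P v x Px x≢v alone
        (M , np) = near-perfect-bounded m (P without x)
                     (≤-pred (subst (_≤ suc m) (card-without P x Px) P≤1+m)) v (OddAt-shrinks odd)
    in M , leave-exposed np
    where
      alone : ∀ z → R x z ≡ true → P z ≡ true → z ≡ x
      alone z Rxz Pz with z ≟ᶠ x | z ≟ᶠ v
      ... | yes z≡x | _ = z≡x
      ... | no _ | yes refl = ⊥-elim (true≢false (∧-intro Rxz Pz) xv)
      ... | no z≢x | no z≢v = ⊥-elim (true≢false (partners⁺ P v x z Rxz Pz z≢x z≢v) (none z))

  near-perfect : (P : VSet n) (v : Fin n) → OddAt P v → Σ (Matching {n}) (NearPerfect P v)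
  near-perfect P v = near-perfect-bounded (card P) P ≤-refl v

∈-zip : ∀ {A B : Set} (as : List A) (bs : List B) {a b} → (a , b) ∈ zip as bs → a ∈ as × b ∈ bs
∈-zip (x ∷ as) (y ∷ bs) (here refl) = here refl , here refl
∈-zip (x ∷ as) (y ∷ bs) (there m) = let (a∈ , b∈) = ∈-zip as bs m in there a∈ , there b∈

module _ {n : ℕ} where

  endpoints-++ : (M₁ M₂ : Matching {n}) → endpoints (M₁ ++ M₂) ≡ endpoints M₁ ++ endpoints M₂
  endpoints-++ [] M₂ = refl
  endpoints-++ ((a , b) ∷ M₁) M₂ = cong (λ z → a ∷ b ∷ z) (endpoints-++ M₁ M₂)

  covered-++ : (M₁ M₂ : Matching {n}) (w : Fin n) → covered (M₁ ++ M₂) w ≡ covered M₁ w ∨ covered M₂ w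
  covered-++ M₁ M₂ w = true⇔⇒≡ to from
    where
      in-++ : w ∈ endpoints M₁ ++ endpoints M₂ → w ∈ endpoints (M₁ ++ M₂)
      in-++ = subst (w ∈_) (sym (endpoints-++ M₁ M₂))
      to : covered (M₁ ++ M₂) w ≡ true → covered M₁ w ∨ covered M₂ w ≡ true
      to c with ∈-++⁻ (endpoints M₁) (subst (w ∈_) (endpoints-++ M₁ M₂) (covered⁻ (M₁ ++ M₂) c))
      ... | inj₁ m = ∨-introˡ _ (covered⁺ M₁ m)
      ... | inj₂ m = ∨-introʳ _ (covered⁺ M₂ m)
      from : covered M₁ w ∨ covered M₂ w ≡ true → covered (M₁ ++ M₂) w ≡ true
      from c with ∨-elim c
      ... | inj₁ c₁ = covered⁺ (M₁ ++ M₂) (in-++ (∈-++⁺ˡ (covered⁻ M₁ c₁)))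
      ... | inj₂ c₂ = covered⁺ (M₁ ++ M₂) (in-++ (∈-++⁺ʳ (endpoints M₁) (covered⁻ M₂ c₂)))

  matching-++ : (H : Graph n) {M₁ M₂ : Matching {n}} → IsMatching H M₁ → IsMatching H M₂ →
    (∀ {z} → z ∈ endpoints M₁ → z ∉ endpoints M₂) → IsMatching H (M₁ ++ M₂)
  matching-++ H {M₁} {M₂} (edges₁ , u₁) (edges₂ , u₂) disjoint =
    Allₚ.++⁺ edges₁ edges₂ ,
    subst Unique (sym (endpoints-++ M₁ M₂)) (++⁺ u₁ u₂ (λ (m₁ , m₂) → disjoint m₁ m₂))

  ∈-endpoints-zip⁻ : (as bs : List (Fin n)) {w : Fin n} → w ∈ endpoints (zip as bs) → w ∈ as ⊎ w ∈ bs
  ∈-endpoints-zip⁻ (a ∷ as) (b ∷ bs) (here e) = inj₁ (here e)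
  ∈-endpoints-zip⁻ (a ∷ as) (b ∷ bs) (there (here e)) = inj₂ (here e)
  ∈-endpoints-zip⁻ (a ∷ as) (b ∷ bs) (there (there m)) with ∈-endpoints-zip⁻ as bs m
  ... | inj₁ p = inj₁ (there p)
  ... | inj₂ p = inj₂ (there p)

  ∈-endpoints-zip⁺ : (as bs : List (Fin n)) → length as ≡ length bs → {w : Fin n} →
    w ∈ as ⊎ w ∈ bs → w ∈ endpoints (zip as bs)
  ∈-endpoints-zip⁺ (a ∷ as) (b ∷ bs) _ (inj₁ (here e)) = here e
  ∈-endpoints-zip⁺ (a ∷ as) (b ∷ bs) _ (inj₂ (here e)) = there (here e)
  ∈-endpoints-zip⁺ (a ∷ as) (b ∷ bs) eq (inj₁ (there m)) =
    there (there (∈-endpoints-zip⁺ as bs (suc-injective eq) (inj₁ m)))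
  ∈-endpoints-zip⁺ (a ∷ as) (b ∷ bs) eq (inj₂ (there m)) =
    there (there (∈-endpoints-zip⁺ as bs (suc-injective eq) (inj₂ m)))

  endpoints-zip-unique : (as bs : List (Fin n)) → Unique as → Unique bs → (∀ {z} → z ∈ as → z ∉ bs) →
    Unique (endpoints (zip as bs))
  endpoints-zip-unique [] bs _ _ _ = []
  endpoints-zip-unique (a ∷ as) [] _ _ _ = []
  endpoints-zip-unique (a ∷ as) (b ∷ bs) ua ub disjoint =
    ∷-unique a∉ (∷-unique b∉ (endpoints-zip-unique as bs (unique-tail ua) (unique-tail ub)
                                (λ p q → disjoint (there p) (there q))))
    where
      a∉ : a ∉ b ∷ endpoints (zip as bs)
      a∉ (here e) = disjoint (here refl) (here e)
      a∉ (there m) with ∈-endpoints-zip⁻ as bs m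
      ... | inj₁ p = Unique[x∷xs]⇒x∉xs ua p
      ... | inj₂ p = disjoint (here refl) (there p)
      b∉ : b ∉ endpoints (zip as bs)
      b∉ m with ∈-endpoints-zip⁻ as bs m
      ... | inj₁ p = disjoint (there p) (here refl)
      ... | inj₂ p = Unique[x∷xs]⇒x∉xs ub p

module DCompleteGraph {n : ℕ} (G : Graph n) (G-sym : ∀ u v → G u v ≡ G v u)
  (G-trans : ∀ u v w → G u v ≡ true → G v w ≡ true → u ≢ w → G u w ≡ true)
  (G-odd : ∀ v → Odd {n} (card (closedNbhd G v)))
  where

  closedNbhd⁻ : ∀ {u w} → closedNbhd G u w ≡ true → w ≡ u ⊎ G u w ≡ true
  closedNbhd⁻ e with ∨-elim e
  ... | inj₁ w≡u = inj₁ (≡ᵇ-≡ w≡u)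
  ... | inj₂ Guw = inj₂ Guw

  closedNbhd-refl : ∀ u → closedNbhd G u u ≡ true
  closedNbhd-refl u = ∨-introˡ _ (≡ᵇ-refl u)

  edge⇒closedNbhd : ∀ {u w} → G u w ≡ true → closedNbhd G u w ≡ true
  edge⇒closedNbhd {u} {w} = ∨-introʳ (w ≡ᵇ u)

  closedNbhd-sym : ∀ u w → closedNbhd G u w ≡ true → closedNbhd G w u ≡ true
  closedNbhd-sym u w e with closedNbhd⁻ e
  ... | inj₁ refl = closedNbhd-refl w
  ... | inj₂ Guw = edge⇒closedNbhd (trans (G-sym w u) Guw)

  closedNbhd-trans : ∀ u v w → closedNbhd G u v ≡ true → closedNbhd G v w ≡ true → closedNbhd G u w ≡ true
  closedNbhd-trans u v w e₁ e₂ with closedNbhd⁻ e₁ | closedNbhd⁻ e₂ | u ≟ᶠ w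
  ... | inj₁ refl | _ | _ = e₂
  ... | _ | inj₁ refl | _ = e₁
  ... | _ | _ | yes refl = closedNbhd-refl u
  ... | inj₂ Guv | inj₂ Gvw | no u≢w = edge⇒closedNbhd (G-trans u v w Guv Gvw u≢w)

  closedNbhd⇒edge : ∀ a b → closedNbhd G a b ≡ true → a ≢ b → G a b ≡ true
  closedNbhd⇒edge a b e a≢b with closedNbhd⁻ e
  ... | inj₁ refl = ⊥-elim (a≢b refl)
  ... | inj₂ Gab = Gab

  open NearPerfectMatching G (closedNbhd G) closedNbhd-refl closedNbhd-sym closedNbhd-trans closedNbhd⇒edge
    public

  maximum-if-exposed-transversal : (M : Matching {n}) → IsMatching G M →
    (∀ t t′ → uncovered M t ≡ true → uncovered M t′ ≡ true → closedNbhd G t t′ ≡ true → t ≡ t′) →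
    ∀ M′ → IsMatching G M′ → length M′ ≤ length M
  maximum-if-exposed-transversal M M-matching transversal M′ M′-matching =
    size-anti-uncovered M M′ (proj₂ M-matching) (proj₂ M′-matching)
      (subst (card (uncovered M) ≤_) no-barrier
        (m+n≤o⇒m≤o _ (deficiency-bound (uncovered M) (λ _ _ → refl) transversal)))
    where open Deficiency G G-sym (λ _ → false) (closedNbhd G) closedNbhd-sym closedNbhd-trans
                 (λ _ _ _ _ → refl) (λ u _ → G-odd u) (λ u w _ _ → edge⇒closedNbhd) M′ M′-matching
          no-barrier : card (uncovered M′) + card (λ (_ : Fin n) → false) ≡ card (uncovered M′)
          no-barrier = trans (cong (card (uncovered M′) +_) (card-empty (λ (_ : Fin n) → false) λ _ → refl))
                             (+-identityʳ _)

  exposed-transversal : ∀ {P v M} → NearPerfect P v M → (∀ w → P w ≡ true) →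
    ∀ t t′ → uncovered M t ≡ true → uncovered M t′ ≡ true → closedNbhd G t t′ ≡ true → t ≡ t′
  exposed-transversal {P} {v} {M} np all t t′ ut ut′ Rtt′ =
    sym (NearPerfect.exposed-alone np (all t) (all t′) Rtt′ (uncovered⇒∉ M ut) (uncovered⇒∉ M ut′))

  odd-everywhere : ∀ v → OddAt (λ _ → true) v
  odd-everywhere v _ =
    subst (Odd {n}) (card-ext (closedNbhd G v) _ (λ z → sym (∧-identityʳ (closedNbhd G v z)))) (G-odd v)

  inessential : ∀ v → InD G v
  inessential v with near-perfect (λ _ → true) v (odd-everywhere v)
  ... | M , np =
    M , (matching , maximum-if-exposed-transversal M matching (exposed-transversal np (λ _ → refl))) , avoids
    where open NearPerfect np

  closedNbhd-clique : ∀ l → IsClique G (closedNbhd G l)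
  closedNbhd-clique l a b la lb a≢b =
    closedNbhd⇒edge a b (closedNbhd-trans a l b (closedNbhd-sym l a la) lb) a≢b

  clique⊆closedNbhd : ∀ {L l} → IsClique G L → L l ≡ true → L ⊆ closedNbhd G l
  clique⊆closedNbhd {L} {l} L-clique Ll u Lu with u ≟ᶠ l
  ... | yes refl = refl
  ... | no u≢l = L-clique l u Ll Lu (u≢l ∘ sym)

  maximal-clique-closed : ∀ {L} → IsMaximalClique G L → ∀ {l} → L l ≡ true →
    ∀ u w → L u ≡ true → G u w ≡ true → L w ≡ true
  maximal-clique-closed (L-clique , L-maximal) {l} Ll u w Lu Guw =
    L-maximal (closedNbhd G l) (closedNbhd-clique l) L⊆N w
      (closedNbhd-trans l u w (L⊆N u Lu) (edge⇒closedNbhd Guw))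
    where L⊆N = clique⊆closedNbhd L-clique Ll

matching-number-cong : ∀ {n} {H H′ : Graph n} {M M′ : Matching {n}} → IsMaximumMatching H M →
  IsMaximumMatching H′ M′ → length M ≡ length M′ → ∀ k → MatchingNumber H k ⇔ MatchingNumber H′ k
matching-number-cong {M = M} {M′} max max′ same k = mk⇔
  (λ (N , (N-matching , N-max) , size) →
    M′ , max′ , trans (sym same) (trans (≤-antisym (N-max M (proj₁ max)) (proj₂ max N N-matching)) size))
  (λ (N , (N-matching , N-max) , size) →
    M , max , trans same (trans (≤-antisym (N-max M′ (proj₁ max′)) (proj₂ max′ N N-matching)) size))

S-K-symmetric : ∀ c d p q → (c ∧ d) ∨ (c ∧ q) ∨ (p ∧ d) ≡ (d ∧ c) ∨ (d ∧ p) ∨ (q ∧ c)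
S-K-symmetric = solve 4 (λ c d p q → c :* d :+ (c :* q :+ p :* d) := d :* c :+ (d :* p :+ q :* c)) refl
  where open ∨-∧-Solver

module Transformation {n : ℕ} (G : Graph n) (G-sym : ∀ u v → G u v ≡ G v u)
  (G-trans : ∀ u v w → G u v ≡ true → G v w ≡ true → u ≢ w → G u w ≡ true)
  (G-odd : ∀ v → Odd {n} (card (closedNbhd G v)))
  (L : VSet n) (κ : ℕ) (L-maximal : IsMaximalClique G L) (card-L : card L ≡ 2 * κ + 1)
  (S : VSet n) (S⊆L : S ⊆ L) (card-S : card S ≡ κ)
  (K : VSet n) (K∩S : ∀ v → K v ≡ true → S v ≡ false) (K-scattered : Scattered G K) (κ<K : κ < card K)
  where

  open DCompleteGraph G G-sym G-trans G-odd

  l₀-in-L : ∃ λ l → L l ≡ true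
  l₀-in-L = card>0⇒witness L (subst (0 <_) (trans (+-comm 1 (2 * κ)) (sym card-L)) (s≤s z≤n))

  l₀ : Fin n
  l₀ = proj₁ l₀-in-L

  L-closed : ∀ u w → L u ≡ true → G u w ≡ true → L w ≡ true
  L-closed = maximal-clique-closed L-maximal (proj₂ l₀-in-L)

  L-closedNbhd : ∀ u w → L u ≡ true → closedNbhd G u w ≡ true → L w ≡ true
  L-closedNbhd u w Lu e with closedNbhd⁻ e
  ... | inj₁ refl = Lu
  ... | inj₂ Guw = L-closed u w Lu Guw

  off-L-closed : ∀ u w → G u w ≡ true → L u ≡ false → L w ≡ false
  off-L-closed u w Guw Lu = ¬-not (λ Lw → true≢false (L-closed w u Lw (trans (G-sym w u) Guw)) Lu)

  off-L⇒off-S : ∀ u → L u ≡ false → S u ≡ false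
  off-L⇒off-S u Lu = ¬-not (λ Su → true≢false (S⊆L u Su) Lu)

  G′ : Graph n
  G′ = modify G L S K

  G′-sym : ∀ u v → G′ u v ≡ G′ v u
  G′-sym u v rewrite G-sym u v | ≡ᵇ-sym u v | ∧-comm (L u) (L v) =
    cong ((G v u ∧ not (L v ∧ L u)) ∨_) (cong (not (v ≡ᵇ u) ∧_) (S-K-symmetric (S u) (S v) (K u) (K v)))

  G′-off-S : ∀ a b → S a ≡ false → S b ≡ false → G′ a b ≡ G a b ∧ not (L a ∧ L b)
  G′-off-S a b Sa Sb rewrite Sa | Sb | ∧-zeroʳ (K a) | ∧-zeroʳ (not (a ≡ᵇ b)) = ∨-identityʳ _

  G′⇒G : ∀ a b → S a ≡ false → S b ≡ false → G′ a b ≡ true → G a b ≡ true × L a ≡ false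
  G′⇒G a b Sa Sb e = Gab , ¬-not (λ La → true≢false (L-closed a b La Gab) (not-both La))
    where
      e′ = trans (sym (G′-off-S a b Sa Sb)) e
      Gab = ∧-elimˡ {G a b} e′
      not-both : L a ≡ true → L b ≡ false
      not-both La = trans (cong (_∧ L b) (sym La)) (not-injective (∧-elimʳ {G a b} e′))

  S-K-edge : ∀ a b → S a ≡ true → K b ≡ true → G′ a b ≡ true
  S-K-edge a b Sa Kb = ∨-introʳ (G a b ∧ not (L a ∧ L b))
    (∧-intro (cong not (≢-≡ᵇ a≢b)) (∨-introʳ (S a ∧ S b) (∨-introˡ (K a ∧ S b) (∧-intro Sa Kb))))
    where a≢b : a ≢ b
          a≢b refl = true≢false Sa (K∩S a Kb)

  -- Comp′ u is the component of u in G′ − S: its G-component if u ∉ L, and {u} if u ∈ L.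
  Comp′ : Fin n → Fin n → Bool
  Comp′ u w = (w ≡ᵇ u) ∨ (G u w ∧ not (L u))

  Comp′⁻ : ∀ {u w} → Comp′ u w ≡ true → w ≡ u ⊎ (G u w ≡ true × L u ≡ false)
  Comp′⁻ {u} {w} e with ∨-elim e
  ... | inj₁ w≡u = inj₁ (≡ᵇ-≡ w≡u)
  ... | inj₂ e′ = inj₂ (∧-elimˡ {G u w} e′ , not-injective (∧-elimʳ {G u w} e′))

  Comp′-refl : ∀ u → Comp′ u u ≡ true
  Comp′-refl u = ∨-introˡ _ (≡ᵇ-refl u)

  edge⇒Comp′ : ∀ {u w} → G u w ≡ true → L u ≡ false → Comp′ u w ≡ true
  edge⇒Comp′ {u} {w} Guw Lu = ∨-introʳ (w ≡ᵇ u) (∧-intro Guw (cong not Lu))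

  Comp′-sym : ∀ u w → Comp′ u w ≡ true → Comp′ w u ≡ true
  Comp′-sym u w e with Comp′⁻ e
  ... | inj₁ refl = Comp′-refl w
  ... | inj₂ (Guw , Lu) = edge⇒Comp′ (trans (G-sym w u) Guw) (off-L-closed u w Guw Lu)

  Comp′-trans : ∀ u v w → Comp′ u v ≡ true → Comp′ v w ≡ true → Comp′ u w ≡ true
  Comp′-trans u v w e₁ e₂ with Comp′⁻ e₁ | Comp′⁻ e₂ | u ≟ᶠ w
  ... | inj₁ refl | _ | _ = e₂
  ... | _ | inj₁ refl | _ = e₁
  ... | _ | _ | yes refl = Comp′-refl u
  ... | inj₂ (Guv , Lu) | inj₂ (Gvw , _) | no u≢w = edge⇒Comp′ (G-trans u v w Guv Gvw u≢w) Lu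

  Comp′⇒G′ : ∀ a b → Comp′ a b ≡ true → a ≢ b → G′ a b ≡ true
  Comp′⇒G′ a b e a≢b with Comp′⁻ e
  ... | inj₁ refl = ⊥-elim (a≢b refl)
  ... | inj₂ (Gab , La) = ∨-introˡ _ (∧-intro Gab (cong (λ x → not (x ∧ L b)) La))

  G′⇒Comp′ : ∀ u w → S u ≡ false → S w ≡ false → G′ u w ≡ true → Comp′ u w ≡ true
  G′⇒Comp′ u w Su Sw e = let (Guw , Lu) = G′⇒G u w Su Sw e in edge⇒Comp′ Guw Lu

  Comp′-avoids-S : ∀ u w → S u ≡ false → Comp′ u w ≡ true → S w ≡ false
  Comp′-avoids-S u w Su e with Comp′⁻ e
  ... | inj₁ refl = Su
  ... | inj₂ (Guw , Lu) = off-L⇒off-S w (off-L-closed u w Guw Lu)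

  Comp′-on-L : ∀ {u} → L u ≡ true → ∀ w → Comp′ u w ≡ (w ≡ᵇ u)
  Comp′-on-L {u} Lu w rewrite Lu | ∧-zeroʳ (G u w) = ∨-identityʳ (w ≡ᵇ u)

  Comp′-off-L : ∀ {u} → L u ≡ false → ∀ w → Comp′ u w ≡ closedNbhd G u w
  Comp′-off-L {u} Lu w rewrite Lu = cong ((w ≡ᵇ u) ∨_) (∧-identityʳ (G u w))

  Comp′-odd : ∀ u → Odd {n} (card (Comp′ u))
  Comp′-odd u = by-L (L u) refl
    where by-L : ∀ b → L u ≡ b → Odd {n} (card (Comp′ u))
          by-L true Lu = 0 , trans (card-ext (Comp′ u) (_≡ᵇ u) (Comp′-on-L Lu)) (card-singleton u)
          by-L false Lu = subst (Odd {n}) (sym (card-ext (Comp′ u) (closedNbhd G u) (Comp′-off-L Lu))) (G-odd u)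

  Comp′-scattered : ∀ t t′ → K t ≡ true → K t′ ≡ true → Comp′ t t′ ≡ true → t ≡ t′
  Comp′-scattered t t′ Kt Kt′ e with Comp′⁻ e | t ≟ᶠ t′
  ... | inj₁ refl | _ = refl
  ... | _ | yes t≡t′ = t≡t′
  ... | inj₂ (Gtt′ , _) | no t≢t′ = ⊥-elim (K-scattered t t′ Kt Kt′ t≢t′ (step Gtt′ tt here))

  L-odd : OddAt L l₀
  L-odd _ = κ , (begin
    card (classIn L l₀) ≡⟨ card-ext _ L (λ z → true⇔⇒≡ (∧-elimʳ {closedNbhd G l₀ z})
                                                      (λ Lz → ∧-intro (L⊆N z Lz) Lz)) ⟩
    card L              ≡⟨ card-L ⟩
    2 * κ + 1           ≡⟨ +-comm (2 * κ) 1 ⟩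
    1 + 2 * κ           ∎)
    where open ≡-Reasoning
          L⊆N = clique⊆closedNbhd (proj₁ L-maximal) (proj₂ l₀-in-L)

  M-L : Matching {n}
  M-L = proj₁ (near-perfect L l₀ L-odd)

  M-L-near-perfect : NearPerfect L l₀ M-L
  M-L-near-perfect = proj₂ (near-perfect L l₀ L-odd)

  covered-M-L : ∀ z → covered M-L z ≡ (L without l₀) z
  covered-M-L z = true⇔⇒≡ to from
    where
      open NearPerfect M-L-near-perfect
      to : covered M-L z ≡ true → (L without l₀) z ≡ true
      to c = ∈-without L l₀ (inside (covered⁻ M-L c)) (λ { refl → avoids (covered⁻ M-L c) })
      from : (L without l₀) z ≡ true → covered M-L z ≡ true
      from e = let (Lz , z≢l₀) = without-⊆ L l₀ e in ¬-not λ c → z≢l₀ (sym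
        (exposed-alone Lz (proj₂ l₀-in-L) (clique⊆closedNbhd (proj₁ L-maximal) Lz l₀ (proj₂ l₀-in-L))
                       (uncovered⇒∉ M-L (cong not c)) avoids))

  size-M-L : length M-L ≡ κ
  size-M-L = *-cancelˡ-≡ (length M-L) κ 2 (begin
    2 * length M-L         ≡⟨ card-covered M-L (proj₂ (NearPerfect.matching M-L-near-perfect)) ⟨
    card (covered M-L)     ≡⟨ card-ext _ _ covered-M-L ⟩
    card (L without l₀)    ≡⟨ suc-injective (trans (sym (card-without L l₀ (proj₂ l₀-in-L)))
                                               (trans card-L (+-comm (2 * κ) 1))) ⟩
    2 * κ                  ∎)
    where open ≡-Reasoning

  module G′-NP = NearPerfectMatching G′ Comp′ Comp′-refl Comp′-sym Comp′-trans Comp′⇒G′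

  module Deficiency′ =
    Deficiency G′ G′-sym S Comp′ Comp′-sym Comp′-trans Comp′-avoids-S (λ u _ → Comp′-odd u) G′⇒Comp′

  S-K-matching : (ss ks : List (Fin n)) → Unique ss → Unique ks → length ss ≡ length ks →
    (∀ {s} → s ∈ ss → S s ≡ true) → (∀ {k} → k ∈ ks → K k ≡ true) →
    IsMatching G′ (zip ss ks)
  S-K-matching ss ks uss uks _ ss⊆S ks⊆K = All.tabulate edge , endpoints-zip-unique ss ks uss uks disjoint
    where
      edge : ∀ {e} → e ∈ zip ss ks → G′ (proj₁ e) (proj₂ e) ≡ true
      edge {a , b} e = let (a∈ , b∈) = ∈-zip ss ks e in S-K-edge a b (ss⊆S a∈) (ks⊆K b∈)
      disjoint : ∀ {z} → z ∈ ss → z ∉ ks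
      disjoint z∈ss z∈ks = true≢false (ss⊆S z∈ss) (K∩S _ (ks⊆K z∈ks))

  -- A maximum matching of G′ missing v ∉ S: S is matched into K outside the component of v,
  -- and the rest near-perfectly inside the components of G′ − S.
  module Avoiding (v : Fin n) (Sv : S v ≡ false) where

    K-v : VSet n
    K-v w = K w ∧ not (Comp′ v w)

    κ≤K-v : κ ≤ card K-v
    κ≤K-v = ≤-pred (≤-trans κ<K
      (subst (_≤ 1 + card K-v) (sym (card-split K (Comp′ v))) (+-monoˡ-≤ (card K-v) K-near-v≤1)))
      where
        K-near-v≤1 : card (λ w → K w ∧ Comp′ v w) ≤ 1
        K-near-v≤1 = card≤1 _ (λ x y Kx Ky → Comp′-scattered x y (∧-elimˡ {K x} Kx) (∧-elimˡ {K y} Ky)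
                       (Comp′-trans x v y (Comp′-sym v x (∧-elimʳ {K x} Kx)) (∧-elimʳ {K y} Ky)))

    K-chosen-list : List (Fin n)
    K-chosen-list = take κ (elements K-v)

    length-K-chosen : length K-chosen-list ≡ κ
    length-K-chosen = trans (length-take κ (elements K-v)) (m≤n⇒m⊓n≡m κ≤K-v)

    K-chosen : VSet n
    K-chosen = inList K-chosen-list

    K-chosen⁻ : ∀ {w} → K-chosen w ≡ true → K w ≡ true × Comp′ v w ≡ false
    K-chosen⁻ {w} e = let in-K-v = ∈-elements⁻ K-v (∈-take⁻ κ (elements K-v) (inList⁻ e)) in
      ∧-elimˡ {K w} in-K-v , not-injective (∧-elimʳ {K w} in-K-v)

    card-K-chosen : card K-chosen ≡ κ
    card-K-chosen = trans
      (sym (length≡card K-chosen K-chosen-list (take⁺ κ (elements-unique K-v)) inList⁺ inList⁻))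
      length-K-chosen

    M-S : Matching {n}
    M-S = zip (elements S) K-chosen-list

    S≡K-chosen : length (elements S) ≡ length K-chosen-list
    S≡K-chosen = trans (length≡card S (elements S) (elements-unique S) (∈-elements⁻ S) (∈-elements⁺ S))
                       (trans card-S (sym length-K-chosen))

    M-S-matching : IsMatching G′ M-S
    M-S-matching = S-K-matching (elements S) K-chosen-list (elements-unique S) (take⁺ κ (elements-unique K-v))
      S≡K-chosen (∈-elements⁻ S) (proj₁ ∘ K-chosen⁻ ∘ inList⁺)

    covered-M-S : ∀ w → covered M-S w ≡ S w ∨ K-chosen w
    covered-M-S w = true⇔⇒≡ to from
      where
        zip⁺ = ∈-endpoints-zip⁺ (elements S) K-chosen-list S≡K-chosen
        to : covered M-S w ≡ true → S w ∨ K-chosen w ≡ true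
        to c with ∈-endpoints-zip⁻ (elements S) K-chosen-list (covered⁻ M-S c)
        ... | inj₁ m = ∨-introˡ (K-chosen w) (∈-elements⁻ S m)
        ... | inj₂ m = ∨-introʳ (S w) (inList⁺ m)
        from : S w ∨ K-chosen w ≡ true → covered M-S w ≡ true
        from e with ∨-elim e
        ... | inj₁ Sw = covered⁺ M-S (zip⁺ (inj₁ (∈-elements⁺ S Sw)))
        ... | inj₂ Kw = covered⁺ M-S (zip⁺ (inj₂ (inList⁻ Kw)))

    size-M-S : length M-S ≡ κ
    size-M-S = trans (length-zipWith _,_ (elements S) K-chosen-list)
      (trans (cong (_⊓ length K-chosen-list) S≡K-chosen) (trans (⊓-idem _) length-K-chosen))

    rest : VSet n
    rest w = not (S w) ∧ not (K-chosen w)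

    rest⁻ : ∀ {w} → rest w ≡ true → S w ≡ false × K-chosen w ≡ false
    rest⁻ {w} e = not-injective (∧-elimˡ {not (S w)} e) , not-injective (∧-elimʳ {not (S w)} e)

    rest⁺ : ∀ {w} → S w ≡ false → K-chosen w ≡ false → rest w ≡ true
    rest⁺ Sw Kw = ∧-intro (cong not Sw) (cong not Kw)

    K-chosen-off-v : K-chosen v ≡ false
    K-chosen-off-v = ¬-not (λ Kv → true≢false (Comp′-refl v) (proj₂ (K-chosen⁻ Kv)))

    rest-odd : G′-NP.OddAt rest v
    rest-odd _ = subst (Odd {n})
      (card-ext (Comp′ v) _ λ z → true⇔⇒≡ (λ e → ∧-intro e (Comp′-v⊆rest z e)) (∧-elimˡ {Comp′ v z}))
      (Comp′-odd v)
      where Comp′-v⊆rest : ∀ z → Comp′ v z ≡ true → rest z ≡ true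
            Comp′-v⊆rest z e =
              rest⁺ (Comp′-avoids-S v z Sv e) (¬-not λ Kz → true≢false e (proj₂ (K-chosen⁻ Kz)))

    M-rest : Matching {n}
    M-rest = proj₁ (G′-NP.near-perfect rest v rest-odd)

    M-rest-near-perfect : G′-NP.NearPerfect rest v M-rest
    M-rest-near-perfect = proj₂ (G′-NP.near-perfect rest v rest-odd)

    open G′-NP.NearPerfect M-rest-near-perfect

    M-v : Matching {n}
    M-v = M-S ++ M-rest

    M-v-matching : IsMatching G′ M-v
    M-v-matching = matching-++ G′ M-S-matching matching λ {z} z∈M-S z∈M-rest →
      let (Sz , Kz) = rest⁻ (inside z∈M-rest) in
      true≢false (trans (sym (covered-M-S z)) (covered⁺ M-S z∈M-S)) (cong₂ _∨_ Sz Kz)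

    covered-M-v : ∀ w → covered M-v w ≡ (S w ∨ K-chosen w) ∨ covered M-rest w
    covered-M-v w = trans (covered-++ M-S M-rest w) (cong (_∨ covered M-rest w) (covered-M-S w))

    v-exposed : v ∉ endpoints M-v
    v-exposed = uncovered⇒∉ M-v (cong not (begin
      covered M-v v                              ≡⟨ covered-M-v v ⟩
      (S v ∨ K-chosen v) ∨ covered M-rest v      ≡⟨ cong₂ (λ a b → (a ∨ b) ∨ covered M-rest v) Sv K-chosen-off-v ⟩
      covered M-rest v                           ≡⟨ ¬-not (avoids ∘ covered⁻ M-rest) ⟩
      false                                      ∎))
      where open ≡-Reasoning

    uncovered-M-v⁻ : ∀ {w} → uncovered M-v w ≡ true → rest w ≡ true × w ∉ endpoints M-rest
    uncovered-M-v⁻ {w} u with ∨-false (trans (sym (covered-M-v w)) (not-injective u))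
    ... | SK , c = let (Sw , Kw) = ∨-false SK in rest⁺ Sw Kw , uncovered⇒∉ M-rest (cong not c)

    -- An exposed vertex of M-rest cannot share its component with a chosen K-vertex:
    -- that component would be its odd class in rest plus one vertex.
    exposed-apart-from-K : ∀ t k → rest t ≡ true → t ∉ endpoints M-rest → K-chosen k ≡ true →
      Comp′ t k ≢ true
    exposed-apart-from-K t k rest-t t∉ Kk t~k = Odd⇒¬Odd[1+m] {n} (exposed-odd rest-t t∉)
      (subst (Odd {n}) (trans (card-without (Comp′ t) k t~k) (cong suc (card-ext _ _ same))) (Comp′-odd t))
      where
        St = proj₁ (rest⁻ rest-t)
        same : ∀ z → (Comp′ t without k) z ≡ G′-NP.classIn rest t z
        same z = true⇔⇒≡
          (λ e → let (t~z , z≢k) = without-⊆ (Comp′ t) k e in ∧-intro t~z (rest⁺ (Comp′-avoids-S t z St t~z)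
             (¬-not λ Kz → z≢k (Comp′-scattered z k (proj₁ (K-chosen⁻ Kz)) (proj₁ (K-chosen⁻ Kk))
               (Comp′-trans z t k (Comp′-sym t z t~z) t~k)))))
          (λ e → ∈-without (Comp′ t) k (∧-elimˡ {Comp′ t z} e)
             λ { refl → true≢false Kk (proj₂ (rest⁻ (∧-elimʳ {Comp′ t z} e))) })

    transversal : VSet n
    transversal w = uncovered M-v w ∨ K-chosen w

    transversal-off-S : ∀ t → transversal t ≡ true → S t ≡ false
    transversal-off-S t e with ∨-elim e
    ... | inj₁ u = proj₁ (rest⁻ (proj₁ (uncovered-M-v⁻ u)))
    ... | inj₂ Kt = K∩S t (proj₁ (K-chosen⁻ Kt))

    transversal-apart : ∀ t t′ → transversal t ≡ true → transversal t′ ≡ true →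
      Comp′ t t′ ≡ true → t ≡ t′
    transversal-apart t t′ e e′ t~t′ with ∨-elim e | ∨-elim e′
    ... | inj₁ u | inj₁ u′ = let (rt , t∉) = uncovered-M-v⁻ u ; (rt′ , t′∉) = uncovered-M-v⁻ u′ in
      sym (exposed-alone rt rt′ t~t′ t∉ t′∉)
    ... | inj₁ u | inj₂ Kt′ = let (rt , t∉) = uncovered-M-v⁻ u in
      ⊥-elim (exposed-apart-from-K t t′ rt t∉ Kt′ t~t′)
    ... | inj₂ Kt | inj₁ u′ = let (rt′ , t′∉) = uncovered-M-v⁻ u′ in
      ⊥-elim (exposed-apart-from-K t′ t rt′ t′∉ Kt (Comp′-sym t t′ t~t′))
    ... | inj₂ Kt | inj₂ Kt′ = Comp′-scattered t t′ (proj₁ (K-chosen⁻ Kt)) (proj₁ (K-chosen⁻ Kt′)) t~t′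

    card-transversal : card transversal ≡ card (uncovered M-v) + κ
    card-transversal = trans (card-∨ (uncovered M-v) K-chosen disjoint) (cong (card (uncovered M-v) +_) card-K-chosen)
      where disjoint : ∀ z → uncovered M-v z ≡ true → K-chosen z ≢ true
            disjoint z u Kz = true≢false Kz (proj₂ (rest⁻ (proj₁ (uncovered-M-v⁻ u))))

    exposure-bound : ∀ M′ → IsMatching G′ M′ →
      card (uncovered M-v) + 2 * card (λ w → S w ∧ uncovered M′ w) ≤ card (uncovered M′)
    exposure-bound M′ M′-matching = +-cancelʳ-≤ κ _ _ (begin
      card (uncovered M-v) + 2 * s-unc + κ  ≡⟨ xy∙z≈xz∙y (card (uncovered M-v)) (2 * s-unc) κ ⟩
      card (uncovered M-v) + κ + 2 * s-unc  ≡⟨ cong (_+ 2 * s-unc) card-transversal ⟨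
      card transversal + 2 * s-unc          ≤⟨ deficiency-bound transversal transversal-off-S transversal-apart ⟩
      card (uncovered M′) + card S          ≡⟨ cong (card (uncovered M′) +_) card-S ⟩
      card (uncovered M′) + κ               ∎)
      where
        open Deficiency′ M′ M′-matching
        open ≤-Reasoning
        s-unc = card (λ w → S w ∧ uncovered M′ w)

    M-v-maximum : IsMaximumMatching G′ M-v
    M-v-maximum = M-v-matching , λ M′ M′-matching →
      size-anti-uncovered M-v M′ (proj₂ M-v-matching) (proj₂ M′-matching)
        (m+n≤o⇒m≤o _ (exposure-bound M′ M′-matching))

    maximum-covers-S : ∀ M′ → IsMaximumMatching G′ M′ → ∀ s → S s ≡ true → s ∈ endpoints M′
    maximum-covers-S M′ (M′-matching , M′-max) s Ss = covered⁻ M′ (¬-not λ unc →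
      0≢1+n (trans (sym no-S-exposed) (card-without _ s (∧-intro Ss (cong not unc)))))
      where
        open ≤-Reasoning
        s-unc = card (λ w → S w ∧ uncovered M′ w)
        no-S-exposed : s-unc ≡ 0
        no-S-exposed = n≤0⇒n≡0 (*-cancelˡ-≤ 2 (+-cancelˡ-≤ (card (uncovered M-v)) _ _ (begin
          card (uncovered M-v) + 2 * s-unc  ≤⟨ exposure-bound M′ M′-matching ⟩
          card (uncovered M′)               ≤⟨ uncovered-anti-size M′ M-v (proj₂ M′-matching) (proj₂ M-v-matching)
                                                 (M′-max M-v M-v-matching) ⟩
          card (uncovered M-v)              ≡⟨ +-identityʳ _ ⟨
          card (uncovered M-v) + 2 * 0      ∎)))

    inessential′ : InD G′ v
    inessential′ = M-v , M-v-maximum , v-exposed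

    M-rest-off-S : ∀ {z} → z ∈ endpoints M-rest → S z ≡ false
    M-rest-off-S = proj₁ ∘ rest⁻ ∘ inside

    M-rest-in-G : IsMatching G M-rest
    M-rest-in-G = All.tabulate (λ { {a , b} e → let (a∈ , b∈) = ∈-endpoints M-rest e in
                    proj₁ (G′⇒G a b (M-rest-off-S a∈) (M-rest-off-S b∈) (All.lookup (proj₁ matching) e)) })
                , proj₂ matching

    M-rest-off-L : ∀ {z} → z ∈ endpoints M-rest → L z ≡ false
    M-rest-off-L {z} z∈ = proj₂ (G′⇒G z (mate M-rest z) (M-rest-off-S z∈)
      (M-rest-off-S (mate-∈-endpoints M-rest (proj₂ matching) z∈)) (mate-adjacent G′ G′-sym M-rest matching z∈))

    M-G : Matching {n}
    M-G = M-rest ++ M-L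

    M-G-matching : IsMatching G M-G
    M-G-matching = matching-++ G M-rest-in-G (NearPerfect.matching M-L-near-perfect)
      λ z∈M-rest z∈M-L → true≢false (NearPerfect.inside M-L-near-perfect z∈M-L) (M-rest-off-L z∈M-rest)

    exposed-off-L⇒transversal : ∀ t → L t ≡ false → t ∉ endpoints M-rest → transversal t ≡ true
    exposed-off-L⇒transversal t Lt t∉ with K-chosen t in Kt
    ... | true = ∨-introʳ (uncovered M-v t) refl
    ... | false = ∨-introˡ false (cong not (begin
      covered M-v t                           ≡⟨ covered-M-v t ⟩
      (S t ∨ K-chosen t) ∨ covered M-rest t   ≡⟨ cong₂ (λ a b → (a ∨ b) ∨ covered M-rest t) (off-L⇒off-S t Lt) Kt ⟩
      covered M-rest t                        ≡⟨ ¬-not (t∉ ∘ covered⁻ M-rest) ⟩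
      false                                   ∎))
      where open ≡-Reasoning

    M-G-exposed⁻ : ∀ {w} → uncovered M-G w ≡ true → w ∉ endpoints M-rest × w ∉ endpoints M-L
    M-G-exposed⁻ {w} u with ∨-false (trans (sym (covered-++ M-rest M-L w)) (not-injective u))
    ... | c-rest , c-L = uncovered⇒∉ M-rest (cong not c-rest) , uncovered⇒∉ M-L (cong not c-L)

    M-G-exposed-apart : ∀ t t′ → uncovered M-G t ≡ true → uncovered M-G t′ ≡ true →
      closedNbhd G t t′ ≡ true → t ≡ t′
    M-G-exposed-apart t t′ u u′ N with L t in Lt
    ... | true = sym (NearPerfect.exposed-alone M-L-near-perfect Lt (L-closedNbhd t t′ Lt N) N
                        (proj₂ (M-G-exposed⁻ u)) (proj₂ (M-G-exposed⁻ u′)))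
    ... | false = transversal-apart t t′ (exposed-off-L⇒transversal t Lt (proj₁ (M-G-exposed⁻ u)))
                    (exposed-off-L⇒transversal t′ Lt′ (proj₁ (M-G-exposed⁻ u′))) (trans (Comp′-off-L Lt t′) N)
      where Lt′ : L t′ ≡ false
            Lt′ = ¬-not λ L′ → true≢false (L-closedNbhd t′ t L′ (closedNbhd-sym t t′ N)) Lt

    M-G-maximum : IsMaximumMatching G M-G
    M-G-maximum = M-G-matching , maximum-if-exposed-transversal M-G M-G-matching M-G-exposed-apart

    size-M-G : length M-G ≡ length M-v
    size-M-G = begin
      length (M-rest ++ M-L)      ≡⟨ length-++ M-rest ⟩
      length M-rest + length M-L  ≡⟨ +-comm (length M-rest) (length M-L) ⟩
      length M-L + length M-rest  ≡⟨ cong (_+ length M-rest) (trans size-M-L (sym size-M-S)) ⟩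
      length M-S + length M-rest  ≡⟨ length-++ M-S ⟨
      length (M-S ++ M-rest)      ∎
      where open ≡-Reasoning

  k₀-in-K : ∃ λ k → K k ≡ true
  k₀-in-K = card>0⇒witness K (≤-trans (s≤s z≤n) κ<K)

  k₀ : Fin n
  k₀ = proj₁ k₀-in-K

  open Avoiding k₀ (K∩S k₀ (proj₂ k₀-in-K)) using (maximum-covers-S; M-G-maximum; M-v-maximum; size-M-G)

  inessential′⇒off-S : ∀ v → InD G′ v → S v ≡ false
  inessential′⇒off-S v (M′ , M′-maximum , v∉) = ¬-not λ Sv → v∉ (maximum-covers-S M′ M′-maximum v Sv)

  A′≡S : ∀ v → InA G′ v ⇔ (S v ≡ true)
  A′≡S v = mk⇔ (λ (v∉D′ , _) → ¬-not (v∉D′ ∘ Avoiding.inessential′ v))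
    λ Sv → (λ v∈D′ → true≢false Sv (inessential′⇒off-S v v∈D′)) ,
           k₀ , Avoiding.inessential′ k₀ (K∩S k₀ (proj₂ k₀-in-K)) , S-K-edge v k₀ Sv (proj₂ k₀-in-K)

  C′≡∅ : ∀ v → ¬ InC G′ v
  C′≡∅ v v∈C′ = by-S (S v) refl
    where by-S : ∀ b → S v ≡ b → ⊥
          by-S true Sv = v∈C′ (inj₂ (Equivalence.from (A′≡S v) Sv))
          by-S false Sv = v∈C′ (inj₁ (Avoiding.inessential′ v Sv))

  D′≡D∖S : ∀ v → InD G′ v ⇔ (InD G v × S v ≡ false)
  D′≡D∖S v = mk⇔ (λ v∈D′ → inessential v , inessential′⇒off-S v v∈D′)
                 (λ (_ , Sv) → Avoiding.inessential′ v Sv)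

  ν-preserved : ∀ k → MatchingNumber G k ⇔ MatchingNumber G′ k
  ν-preserved = matching-number-cong M-G-maximum M-v-maximum size-M-G

  reach′⇒reach : ∀ {a b} → Reach G′ (InD G′) a b → S a ≡ false → Reach G Everything a b
  reach′⇒reach here _ = here
  reach′⇒reach (step {u} {w} e w∈D′ r) Su = let Sw = inessential′⇒off-S w w∈D′ in
    step (proj₁ (G′⇒G u w Su Sw e)) tt (reach′⇒reach r Sw)

  reach′-on-L : ∀ {a b} → Reach G′ (InD G′) a b → S a ≡ false → L a ≡ true → a ≡ b
  reach′-on-L here _ _ = refl
  reach′-on-L (step {a} {w} e w∈D′ _) Sa La =
    ⊥-elim (true≢false La (proj₂ (G′⇒G a w Sa (inessential′⇒off-S w w∈D′) e)))

  reach⇒reach′ : ∀ {a b} → Reach G Everything a b → L a ≡ false → Reach G′ (InD G′) a b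
  reach⇒reach′ here _ = here
  reach⇒reach′ (step {u} {w} Guw _ r) Lu = let Lw = off-L-closed u w Guw Lu ; Sw = off-L⇒off-S w Lw in
    step (trans (G′-off-S u w (off-L⇒off-S u Lu) Sw) (cong₂ (λ g l → g ∧ not (l ∧ L w)) Guw Lu))
         (Avoiding.inessential′ w Sw) (reach⇒reach′ r Lw)

  components′ : ∀ u v → InD G′ u → Reach G′ (InD G′) u v ⇔
    ((L u ≡ false × Reach G Everything u v) ⊎ (L u ≡ true × u ≡ v))
  components′ u v u∈D′ = mk⇔ to from
    where
      Su = inessential′⇒off-S u u∈D′
      to : Reach G′ (InD G′) u v → (L u ≡ false × Reach G Everything u v) ⊎ (L u ≡ true × u ≡ v)
      to r with L u in Lu
      ... | false = inj₁ (refl , reach′⇒reach r Su)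
      ... | true = inj₂ (refl , reach′-on-L r Su Lu)
      from : (L u ≡ false × Reach G Everything u v) ⊎ (L u ≡ true × u ≡ v) → Reach G′ (InD G′) u v
      from (inj₁ (Lu , r)) = reach⇒reach′ r Lu
      from (inj₂ (_ , refl)) = here

lemma2p11 : {n : ℕ} (G : Graph n) → IsSimple G → DComplete G →
    (L : VSet n) (κ : ℕ) → 0 < κ → IsMaximalClique G L → card L ≡ 2 * κ + 1 →
    (S : VSet n) → S ⊆ L → card S ≡ κ →
    (K : VSet n) → (∀ v → K v ≡ true → S v ≡ false) → Scattered G K → κ < card K →
    let G′ = modify G L S K in
    (∀ v → ¬ InC G′ v)
    × (∀ v → InA G′ v ⇔ (S v ≡ true))
    × (∀ v → InD G′ v ⇔ (InD G v × S v ≡ false))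
    × (∀ k → MatchingNumber G k ⇔ MatchingNumber G′ k)
    × (∀ u v → InD G′ u → InD G′ v →
         Reach G′ (InD G′) u v ⇔
           ((L u ≡ false × Reach G Everything u v) ⊎ (L u ≡ true × u ≡ v)))
lemma2p11 G (G-sym , _) (G-trans , G-odd) L κ _ L-maximal card-L S S⊆L card-S K K∩S K-scattered κ<K =
  C′≡∅ , A′≡S , D′≡D∖S , ν-preserved , λ u v u∈D′ _ → components′ u v u∈D′
  where open Transformation G G-sym G-trans G-odd L κ L-maximal card-L S S⊆L card-S K K∩S K-scattered κ<K
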